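{- Let $n\ge1$ be an integer, $\nu=n+\frac12$, and let $z_1,\dots,z_n$ be the zeros of the Bessel polynomial $\theta_n(z)=\sum_{m=0}^{n}\frac{(n+m)!}{2^m(n-m)!\,m!}z^{n-m}$, listed in a fixed order. Let $\frac{1}{\tilde z_k}=\sum_{i=1}^{k-1}\frac{1}{z_i-z_k}+\sum_{i=k+1}^{n}\left(\frac{1}{z_i-z_k}-\frac{1}{z_i}\right)$, and for integers $s,a,b$ let $\zeta_{\mathcal Z}(s)=\sum_{j=1}^nz_j^{ -s}$, $\zeta_{\mathcal Z}(a,b)=\sum_{n\ge n_1>n_2\ge1}z_{n_1}^{ -a}z_{n_2}^{ -b}$ and $\tilde\zeta_{\mathcal Z}(s)=\sum_{k=1}^n\frac{1}{\tilde z_kz_k^{s-1}}$. Then $$\frac{1}{\tilde z_k}=-1-\frac{\nu-\frac12}{z_k}-\sum_{j=k+1}^{n}\frac{1}{z_j}\quad(1\le k\le n),$$ for every integer $s$, $$\tilde\zeta_{\mathcal Z}(s)=\left(\tfrac12-\nu\right)\zeta_{\mathcal Z}(s)-\zeta_{\mathcal Z}(s-1)-\zeta_{\mathcal Z}(1,s-1),$$ for every integer $s\ge0$, $$\zeta_{\mathcal Z}(s+3)=\frac{2}{1-2\nu}\left[\zeta_{\mathcal Z}(s+2)+\sum_{\substack{a+b=s\\ a\ge-1,\ b\ge0}}\zeta_{\mathcal Z}(2+a,1+b)\right],$$ and in particular $\zeta_{\mathcal Z}(2)+\zeta_{\mathcal Z}(1)\zeta_{\mathcal Z}(2)=\left(\tfrac32-\nu\right)\zeta_{\mathcal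 Z}(3)$.
   Context: The zeros of $\theta_n$ are simple and nonzero (so the definitions make sense). -}

module Defs where

open import Level using (Level; _⊔_)
open import Algebra.Bundles using (CommutativeRing)
open import Data.Nat as ℕ using (ℕ; zero; suc)
open import Data.Nat using (_!)
open import Data.Integer as ℤ using (ℤ; +_; -[1+_])
open import Data.Fin as Fin using (Fin; toℕ)
open import Data.Bool using (if_then_else_)
open import Relation.Nullary using (¬_; does)

-- A field: a commutative ring with a (total) inversion operation that is a
-- genuine inverse on nonzero elements (the value 0⁻¹ is irrelevant/unconstrained),
-- and 0 ≠ 1.
record Field (c ℓ : Level) : Set (Level.suc (c ⊔ ℓ)) where
  field
    commutativeRing : CommutativeRing c ℓ
  open CommutativeRing commutativeRing public
  field
    _⁻¹     : Carrier → Carrier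
    inverse : ∀ x → ¬ (x ≈ 0#) → (x * (x ⁻¹)) ≈ 1#
    0≉1     : ¬ (0# ≈ 1#)

module FieldOps {c ℓ} (F : Field c ℓ) where
  open Field F

  ι : ℕ → Carrier
  ι zero    = 0#
  ι (suc m) = 1# + ι m

  CharZero : Set ℓ
  CharZero = ∀ m → ¬ (ι (suc m) ≈ 0#)

  infixl 7 _/_
  _/_ : Carrier → Carrier → Carrier
  x / y = x * (y ⁻¹)

  _^ℕ_ : Carrier → ℕ → Carrier
  x ^ℕ zero    = 1#
  x ^ℕ (suc m) = x * (x ^ℕ m)

  _^ℤ_ : Carrier → ℤ → Carrier
  x ^ℤ (+ m)      = x ^ℕ m
  x ^ℤ -[1+ m ]   = (x ⁻¹) ^ℕ (suc m)

  Σ : ∀ {n} → (Fin n → Carrier) → Carrier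
  Σ {zero}  f = 0#
  Σ {suc n} f = f Fin.zero + Σ (λ i → f (Fin.suc i))

  Π : ∀ {n} → (Fin n → Carrier) → Carrier
  Π {zero}  f = 1#
  Π {suc n} f = f Fin.zero * Π (λ i → f (Fin.suc i))

  Σ< : ∀ {n} → Fin n → (Fin n → Carrier) → Carrier
  Σ< k f = Σ (λ i → if does (toℕ i ℕ.<? toℕ k) then f i else 0#)

  Σ> : ∀ {n} → Fin n → (Fin n → Carrier) → Carrier
  Σ> k f = Σ (λ i → if does (toℕ k ℕ.<? toℕ i) then f i else 0#)

  half : Carrier
  half = (1# + 1#) ⁻¹

  ν : ℕ → Carrier
  ν n = ι n + half

  θ : ℕ → Carrier → Carrier
  θ n x = Σ {suc n} (λ m →
            ι ((n ℕ.+ toℕ m) !) / ι ((2 ℕ.^ toℕ m) ℕ.* ((n ℕ.∸ toℕ m) !) ℕ.* (toℕ m !))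
            * (x ^ℕ (n ℕ.∸ toℕ m)))

  -- z : Fin n → F lists the zeros z_1,…,z_n (index i ↔ z_{i+1}) of θ_n,
  -- i.e. θ_n(x) = ∏ (x − z_i) identically (θ_n is monic: its m = 0 coefficient is 1).
  IsZeroList : (n : ℕ) → (Fin n → Carrier) → Set (c ⊔ ℓ)
  IsZeroList n z = ∀ x → θ n x ≈ Π (λ i → x - z i)

  module Zeta {n : ℕ} (z : Fin n → Carrier) where
    ζ : ℤ → Carrier
    ζ s = Σ (λ j → z j ^ℤ (ℤ.- s))

    ζ₂ : ℤ → ℤ → Carrier
    ζ₂ a b = Σ (λ i → Σ< i (λ j → (z i ^ℤ (ℤ.- a)) * (z j ^ℤ (ℤ.- b))))

    invZt : Fin n → Carrier
    invZt k = Σ< k (λ i → (z i - z k) ⁻¹)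
            + Σ> k (λ i → (z i - z k) ⁻¹ - (z i) ⁻¹)

    ζ̃ : ℤ → Carrier
    ζ̃ s = Σ (λ k → invZt k * (z k ^ℤ (ℤ.- (s ℤ.- ℤ.+ 1))))

module Submission where

-- θₙ satisfies x θ″ − 2(x + n) θ′ + 2n θ = 0 (a recurrence of its coefficients).
-- In characteristic zero θₙ = P = ∏ᵢ (X − zᵢ) as coefficient lists (identity
-- theorem at the points 1, 2, 3, …).  At a simple root P(z_k) = 0, P′(z_k) ≠ 0 and
-- P″(z_k) = 2P′(z_k) Σ_{i≠k} 1/(z_k − zᵢ), so the equation at z_k yields the
-- Stieltjes relations Σ_{i≠k} 1/(zᵢ − z_k) = −1 − n/z_k.  All four assertions
-- follow from these relations alone (module PowerSums): the first by splitting
-- off Σ_{j>k}, the second by summing against z_k^(1−s), the third by summing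
-- against z_k^(−m) and symmetrising the double sum, where
-- (u^m − v^m)/(u − v) expands geometrically, and the fourth is the case m = 2
-- together with ζ(1)ζ(2) = ζ(3) + ζ(1,2) + ζ(2,1).

open import Defs
open import Data.Nat as ℕ using (ℕ; _≤_; zero; suc; _!)
import Data.Nat.Properties as ℕP
import Data.Nat.Solver
open import Data.Integer as ℤ using (ℤ; +_; -[1+_])
import Data.Integer.Properties as ℤP
import Data.Integer.Solver
open import Data.Sign as Sign using ()
open import Data.Fin as Fin using (Fin; toℕ; opposite)
import Data.Fin.Properties as FinP
open import Data.Fin.Permutation using (reverse)
open import Data.Bool using (true; false; if_then_else_)
open import Data.Empty using (⊥-elim)
open import Data.List using (List; []; _∷_; length; applyUpTo)
open import Data.Maybe using (Maybe; just; nothing)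
open import Data.Product using (_×_; _,_; proj₁; proj₂)
open import Relation.Binary.PropositionalEquality as P using (_≡_)
open import Relation.Binary.Definitions using (Tri; tri<; tri≈; tri>)
open import Relation.Nullary using (Dec; _because_; yes; no; ¬_; does)
open import Relation.Nullary.Reflects using (invert)
open import Algebra.Solver.Ring.AlmostCommutativeRing as ACR
  using (_-Raw-AlmostCommutative⟶_)
import Algebra.Solver.Ring
import Algebra.Properties.Group as GroupProperties
import Algebra.Properties.Ring as RingProperties
import Algebra.Properties.AbelianGroup as AbelianGroupProperties
import Algebra.Properties.CommutativeSemigroup as CommutativeSemigroupProperties
import Algebra.Properties.Semiring.Sum as SumProperties
import Algebra.Properties.Semiring.Mult.TCOptimised as MultProperties

besselDenominator : ℕ → ℕ → ℕ
besselDenominator n m = (2 ℕ.^ m) ℕ.* ((n ℕ.∸ m) !) ℕ.* (m !)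

-- The arithmetic behind the recurrence of the Bessel coefficients: with
-- n = j + 1 + k (so 2n - j = n + k + 1 and n - j = k + 1),
-- (j+1)(2n-j) · (n+k)!/den(n,k) = 2(n-j) · (n+k+1)!/den(n,k+1), cross-multiplied.
bessel-recurrenceℕ : ∀ j k → let n = suc (j ℕ.+ k) in
  suc j ℕ.* (n ℕ.+ suc k) ℕ.* (n ℕ.+ k) ! ℕ.* besselDenominator n (suc k)
    ≡ 2 ℕ.* suc k ℕ.* (n ℕ.+ suc k) ! ℕ.* besselDenominator n k
bessel-recurrenceℕ j k
  rewrite ℕP.m+n∸n≡m j k
        | ℕP.m+n∸n≡m (suc j) k
        | ℕP.+-suc (j ℕ.+ k) k =
  solve 7 (λ j k N X P J K →
      (con 1 :+ j) :* (con 1 :+ N) :* X :* (con 2 :* P :* J :* ((con 1 :+ k) :* K))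
    := con 2 :* (con 1 :+ k) :* ((con 1 :+ N) :* X) :* (P :* ((con 1 :+ j) :* J) :* K))
    P.refl j k (suc (j ℕ.+ k) ℕ.+ k) ((suc (j ℕ.+ k) ℕ.+ k) !) (2 ℕ.^ k) (j !) (k !)
  where open Data.Nat.Solver.+-*-Solver

besselDenominator-nonzero : ∀ n m → ¬ (besselDenominator n m ≡ 0)
besselDenominator-nonzero n m = ℕ.≢-nonZero⁻¹ (besselDenominator n m)
  {{ℕP.m*n≢0 _ _ {{ℕP.m*n≢0 _ _ {{ℕP.m^n≢0 2 m}} {{(n ℕ.∸ m) ℕP.!≢0}}}} {{m ℕP.!≢0}}}}

module _ where
  open Data.Integer.Solver.+-*-Solver

  exponent-step : ∀ s → (ℤ.- (s ℤ.- + 1)) ℤ.- + 1 ≡ ℤ.- s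
  exponent-step = solve 1 (λ s → (:- (s :- con (+ 1))) :- con (+ 1) := :- s) P.refl

  -- 2 + a and 1 + b for a = t - 1 and b = s - a, as natural numbers
  first-exponent : ∀ t → + 2 ℤ.+ ((+ t) ℤ.- + 1) ≡ + suc t
  first-exponent t = solve 1 (λ t → con (+ 2) :+ (t :- con (+ 1)) := con (+ 1) :+ t) P.refl (+ t)

  second-exponent : ∀ s t → t ℕ.≤ suc (suc s) → + 1 ℤ.+ ((+ s) ℤ.- ((+ t) ℤ.- + 1)) ≡ + (suc (suc s) ℕ.∸ t)
  second-exponent s t t≤s+2 = P.trans
    (solve 2 (λ s t → con (+ 1) :+ (s :- (t :- con (+ 1))) := (con (+ 2) :+ s) :- t) P.refl (+ s) (+ t))
    (P.trans (ℤP.m-n≡m⊖n (suc (suc s)) t) (ℤP.⊖-≥ t≤s+2))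

module FieldTheory {c ℓ} (F : Field c ℓ) where
  open Field F hiding (zero)
  open FieldOps F
  open import Relation.Binary.Reasoning.Setoid setoid
  private
    module G = GroupProperties +-group
    module R = RingProperties ring
    module AG = AbelianGroupProperties +-abelianGroup
    module M = MultProperties semiring
    open CommutativeSemigroupProperties *-commutativeSemigroup using () renaming (interchange to *-interchange)

  -- Integer numerals in F.  `numeral` sends + 2 to the literal 1# + 1#
  -- (the library's optimised multiple m ⨯ 1#), so that solver constants
  -- coincide definitionally with the constants written in goals.
  open M using () renaming (_×_ to _⨯_)

  numeral : ℤ → Carrier
  numeral (+ m)    = m ⨯ 1#
  numeral -[1+ m ] = - (suc m ⨯ 1#)

  ι≈× : ∀ m → ι m ≈ m ⨯ 1#
  ι≈× zero    = refl
  ι≈× (suc m) = trans (+-congˡ (ι≈× m)) (sym (M.1+× m 1#))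

  ι-+ : ∀ m n → ι (m ℕ.+ n) ≈ ι m + ι n
  ι-+ m n = trans (ι≈× (m ℕ.+ n))
    (trans (M.×-homo-+ 1# m n) (sym (+-cong (ι≈× m) (ι≈× n))))

  ι-* : ∀ m n → ι (m ℕ.* n) ≈ ι m * ι n
  ι-* m n = trans (ι≈× (m ℕ.* n))
    (trans (M.×1-homo-* m n) (sym (*-cong (ι≈× m) (ι≈× n))))

  ι-*² : ∀ a b d → ι (a ℕ.* b ℕ.* d) ≈ ι a * ι b * ι d
  ι-*² a b d = trans (ι-* (a ℕ.* b) d) (*-congʳ (ι-* a b))

  ι-*³ : ∀ a b d e → ι (a ℕ.* b ℕ.* d ℕ.* e) ≈ ι a * ι b * ι d * ι e
  ι-*³ a b d e = trans (ι-* (a ℕ.* b ℕ.* d) e) (*-congʳ (ι-*² a b d))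

  private
    ⊖-homo : ∀ m n → numeral (m ℤ.⊖ n) ≈ m ⨯ 1# - n ⨯ 1#
    ⊖-homo zero    zero    = sym (-‿inverseʳ 0#)
    ⊖-homo zero    (suc n) = sym (+-identityˡ _)
    ⊖-homo (suc m) zero    = sym (trans (+-congˡ G.ε⁻¹≈ε) (+-identityʳ _))
    ⊖-homo (suc m) (suc n) rewrite ℤP.[1+m]⊖[1+n]≡m⊖n m n = begin
      numeral (m ℤ.⊖ n)                          ≈⟨ ⊖-homo m n ⟩
      m ⨯ 1# - n ⨯ 1#                            ≈⟨ +-congʳ (sym (+-identityˡ _)) ⟩
      (0# + m ⨯ 1#) - n ⨯ 1#                     ≈⟨ +-congʳ (+-congʳ (sym (-‿inverseʳ 1#))) ⟩
      ((1# - 1#) + m ⨯ 1#) - n ⨯ 1#              ≈⟨ +-congʳ (+-assoc _ _ _) ⟩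
      (1# + (- 1# + m ⨯ 1#)) - n ⨯ 1#            ≈⟨ +-congʳ (+-congˡ (+-comm _ _)) ⟩
      (1# + (m ⨯ 1# - 1#)) - n ⨯ 1#              ≈⟨ +-congʳ (sym (+-assoc _ _ _)) ⟩
      ((1# + m ⨯ 1#) - 1#) - n ⨯ 1#              ≈⟨ +-assoc _ _ _ ⟩
      (1# + m ⨯ 1#) + (- 1# - n ⨯ 1#)            ≈⟨ +-congˡ (AG.⁻¹-∙-comm _ _) ⟩
      (1# + m ⨯ 1#) - (1# + n ⨯ 1#)              ≈⟨ sym (+-cong (M.1+× m 1#) (-‿cong (M.1+× n 1#))) ⟩
      suc m ⨯ 1# - suc n ⨯ 1#                    ∎

    ◃-homo : ∀ s k → numeral (s ℤ.◃ k) ≈ numeral (s ℤ.◃ 1) * k ⨯ 1#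
    ◃-homo Sign.+ zero    = sym (*-identityˡ _)
    ◃-homo Sign.+ (suc k) = sym (*-identityˡ _)
    ◃-homo Sign.- zero    = trans (sym G.ε⁻¹≈ε) (trans (-‿cong (sym (*-identityˡ 0#))) (R.-‿distribˡ-* 1# 0#))
    ◃-homo Sign.- (suc k) = trans (-‿cong (sym (*-identityˡ _))) (R.-‿distribˡ-* 1# _)

  numeral-+ : ∀ i j → numeral (i ℤ.+ j) ≈ numeral i + numeral j
  numeral-+ (+ m)    (+ n)    = M.×-homo-+ 1# m n
  numeral-+ (+ m)    -[1+ n ] = ⊖-homo m (suc n)
  numeral-+ -[1+ m ] (+ n)    = trans (⊖-homo n (suc m)) (+-comm _ _)
  numeral-+ -[1+ m ] -[1+ n ] = begin
    - (suc (suc (m ℕ.+ n)) ⨯ 1#)        ≡⟨ P.cong (λ k → - (k ⨯ 1#)) (P.sym (ℕP.+-suc (suc m) n)) ⟩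
    - ((suc m ℕ.+ suc n) ⨯ 1#)          ≈⟨ -‿cong (M.×-homo-+ 1# (suc m) (suc n)) ⟩
    - (suc m ⨯ 1# + suc n ⨯ 1#)         ≈⟨ sym (AG.⁻¹-∙-comm _ _) ⟩
    - (suc m ⨯ 1#) + - (suc n ⨯ 1#)     ∎

  numeral-neg : ∀ i → numeral (ℤ.- i) ≈ - numeral i
  numeral-neg (+ zero)  = sym G.ε⁻¹≈ε
  numeral-neg (+ suc n) = refl
  numeral-neg -[1+ n ]  = sym (G.⁻¹-involutive _)

  numeral-* : ∀ i j → numeral (i ℤ.* j) ≈ numeral i * numeral j
  numeral-* i j = begin
    numeral (ℤ.sign i Sign.* ℤ.sign j ℤ.◃ ℤ.∣ i ∣ ℕ.* ℤ.∣ j ∣)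
      ≈⟨ ◃-homo (ℤ.sign i Sign.* ℤ.sign j) (ℤ.∣ i ∣ ℕ.* ℤ.∣ j ∣) ⟩
    numeral (ℤ.sign i Sign.* ℤ.sign j ℤ.◃ 1) * (ℤ.∣ i ∣ ℕ.* ℤ.∣ j ∣) ⨯ 1#
      ≈⟨ *-cong (signs (ℤ.sign i) (ℤ.sign j)) (M.×1-homo-* ℤ.∣ i ∣ ℤ.∣ j ∣) ⟩
    (numeral (ℤ.sign i ℤ.◃ 1) * numeral (ℤ.sign j ℤ.◃ 1)) * (ℤ.∣ i ∣ ⨯ 1# * ℤ.∣ j ∣ ⨯ 1#)
      ≈⟨ *-interchange _ _ _ _ ⟩
    (numeral (ℤ.sign i ℤ.◃ 1) * ℤ.∣ i ∣ ⨯ 1#) * (numeral (ℤ.sign j ℤ.◃ 1) * ℤ.∣ j ∣ ⨯ 1#)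
      ≈⟨ sym (*-cong (unsplit i) (unsplit j)) ⟩
    numeral i * numeral j ∎
    where
    signs : ∀ s t → numeral (s Sign.* t ℤ.◃ 1) ≈ numeral (s ℤ.◃ 1) * numeral (t ℤ.◃ 1)
    signs Sign.+ Sign.+ = sym (*-identityˡ _)
    signs Sign.+ Sign.- = sym (*-identityˡ _)
    signs Sign.- Sign.+ = sym (*-identityʳ _)
    signs Sign.- Sign.- = sym (trans (R.-1*x≈-x (- 1#)) (G.⁻¹-involutive 1#))
    unsplit : ∀ i → numeral i ≈ numeral (ℤ.sign i ℤ.◃ 1) * ℤ.∣ i ∣ ⨯ 1#
    unsplit i = trans (P.subst (λ k → numeral i ≈ numeral k) (P.sym (ℤP.◃-inverse i)) refl)
                      (◃-homo (ℤ.sign i) ℤ.∣ i ∣)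

  private
    numeral-morphism : ℤ.+-*-rawRing -Raw-AlmostCommutative⟶ ACR.fromCommutativeRing commutativeRing
    numeral-morphism = record
      { ⟦_⟧    = numeral
      ; +-homo = numeral-+
      ; *-homo = numeral-*
      ; -‿homo = numeral-neg
      ; 0-homo = refl
      ; 1-homo = refl
      }

    weak-≟ : ∀ i j → Maybe (numeral i ≈ numeral j)
    weak-≟ i j with i ℤ.≟ j
    ... | yes P.refl = just refl
    ... | no _       = nothing

  open Algebra.Solver.Ring ℤ.+-*-rawRing (ACR.fromCommutativeRing commutativeRing)
    numeral-morphism weak-≟
    using (solve; _:=_; _:+_; _:*_; _:-_; :-_; con)

  inverseˡ : ∀ {x} → ¬ (x ≈ 0#) → x ⁻¹ * x ≈ 1#
  inverseˡ {x} x≉0 = trans (*-comm _ _) (inverse x x≉0)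

  cancelˡ : ∀ {a x y} → ¬ (a ≈ 0#) → a * x ≈ a * y → x ≈ y
  cancelˡ {a} {x} {y} a≉0 eq = begin
    x               ≈⟨ sym (*-identityˡ x) ⟩
    1# * x          ≈⟨ *-congʳ (sym (inverseˡ a≉0)) ⟩
    (a ⁻¹ * a) * x  ≈⟨ *-assoc _ _ _ ⟩
    a ⁻¹ * (a * x)  ≈⟨ *-congˡ eq ⟩
    a ⁻¹ * (a * y)  ≈⟨ sym (*-assoc _ _ _) ⟩
    (a ⁻¹ * a) * y  ≈⟨ *-congʳ (inverseˡ a≉0) ⟩
    1# * y          ≈⟨ *-identityˡ y ⟩
    y               ∎

  zero-product : ∀ {a b} → ¬ (a ≈ 0#) → a * b ≈ 0# → b ≈ 0#
  zero-product a≉0 eq = cancelˡ a≉0 (trans eq (sym (zeroʳ _)))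

  nonzero-* : ∀ {a b} → ¬ (a ≈ 0#) → ¬ (b ≈ 0#) → ¬ (a * b ≈ 0#)
  nonzero-* a≉0 b≉0 eq = b≉0 (zero-product a≉0 eq)

  inverse-unique : ∀ {a b} → a * b ≈ 1# → b ≈ a ⁻¹
  inverse-unique {a} {b} eq = cancelˡ a≉0 (trans eq (sym (inverse a a≉0)))
    where
    a≉0 : ¬ (a ≈ 0#)
    a≉0 a≈0 = 0≉1 (trans (sym (zeroˡ b)) (trans (*-congʳ (sym a≈0)) eq))

  nonzero-⁻¹ : ∀ {a} → ¬ (a ≈ 0#) → ¬ (a ⁻¹ ≈ 0#)
  nonzero-⁻¹ a≉0 e = 0≉1 (trans (sym (zeroʳ _)) (trans (*-congˡ (sym e)) (inverse _ a≉0)))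

  nonzero-neg : ∀ {x} → ¬ (x ≈ 0#) → ¬ (- x ≈ 0#)
  nonzero-neg x≉0 e = x≉0 (trans (sym (G.⁻¹-involutive _)) (trans (-‿cong e) G.ε⁻¹≈ε))

  nonzero-difference : ∀ {x y} → ¬ (x ≈ y) → ¬ (x - y ≈ 0#)
  nonzero-difference {x} {y} x≉y e = x≉y (begin
    x            ≈⟨ solve 2 (λ x y → x := (x :- y) :+ y) refl x y ⟩
    (x - y) + y  ≈⟨ +-congʳ e ⟩
    0# + y       ≈⟨ +-identityˡ y ⟩
    y            ∎)

  inverse-swap : ∀ {a b} → ¬ (a ≈ b) → (b - a) ⁻¹ ≈ - (a - b) ⁻¹
  inverse-swap {a} {b} a≉b = sym (inverse-unique (trans
    (solve 3 (λ a b d → (b :- a) :* (:- d) := (a :- b) :* d) refl a b ((a - b) ⁻¹))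
    (inverse _ (nonzero-difference a≉b))))

  ι-injective : CharZero → ∀ i j → ι i ≈ ι j → i ≡ j
  ι-injective cz zero    zero    e = P.refl
  ι-injective cz zero    (suc j) e = ⊥-elim (cz j (sym e))
  ι-injective cz (suc i) zero    e = ⊥-elim (cz i e)
  ι-injective cz (suc i) (suc j) e = P.cong suc (ι-injective cz i j (G.∙-cancelˡ 1# (ι i) (ι j) e))

  ι-nonzero : CharZero → ∀ {m} → ¬ (m ≡ 0) → ¬ (ι m ≈ 0#)
  ι-nonzero cz {zero}  m≢0 = ⊥-elim (m≢0 P.refl)
  ι-nonzero cz {suc m} m≢0 = cz m

  two-nonzero : CharZero → ¬ (1# + 1# ≈ 0#)
  two-nonzero cz e = cz 1 (trans (+-congˡ (+-identityʳ 1#)) e)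

  cross-multiply : ∀ {a f g b f' g'} → ¬ (g ≈ 0#) → ¬ (g' ≈ 0#) →
                   a * f * g' ≈ b * f' * g → a * (f / g) ≈ b * (f' / g')
  cross-multiply {a} {f} {g} {b} {f'} {g'} g≉0 g'≉0 e = cancelˡ (nonzero-* g≉0 g'≉0) (begin
    (g * g') * (a * (f * g ⁻¹))   ≈⟨ solve 5 (λ g g' a f gi → (g :* g') :* (a :* (f :* gi)) := (a :* f :* g') :* (g :* gi)) refl g g' a f (g ⁻¹) ⟩
    (a * f * g') * (g * g ⁻¹)     ≈⟨ *-cong e (inverse g g≉0) ⟩
    (b * f' * g) * 1#             ≈⟨ *-congˡ (sym (inverse g' g'≉0)) ⟩
    (b * f' * g) * (g' * g' ⁻¹)   ≈⟨ solve 5 (λ g g' b f gi → (b :* f :* g) :* (g' :* gi) := (g :* g') :* (b :* (f :* gi))) refl g g' b f' (g' ⁻¹) ⟩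
    (g * g') * (b * (f' * g' ⁻¹)) ∎)

  private
    module S = SumProperties semiring

  Σ≡sum : ∀ {n} (f : Fin n → Carrier) → Σ f ≡ S.sum f
  Σ≡sum {zero}  f = P.refl
  Σ≡sum {suc n} f = P.cong (λ s → f Fin.zero + s) (Σ≡sum (λ i → f (Fin.suc i)))

  private
    via-sum : ∀ {m n} (f : Fin m → Carrier) (g : Fin n → Carrier) → S.sum f ≈ S.sum g → Σ f ≈ Σ g
    via-sum f g e = trans (reflexive (Σ≡sum f)) (trans e (reflexive (P.sym (Σ≡sum g))))

  Σ-cong : ∀ {n} {f g : Fin n → Carrier} → (∀ i → f i ≈ g i) → Σ f ≈ Σ g
  Σ-cong {f = f} {g} eq = via-sum f g (S.sum-cong-≋ eq)

  Σ-zero : ∀ n → Σ {n} (λ _ → 0#) ≈ 0#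
  Σ-zero n = trans (reflexive (Σ≡sum {n} _)) (S.sum-replicate-zero n)

  Σ-+ : ∀ {n} (f g : Fin n → Carrier) → Σ (λ i → f i + g i) ≈ Σ f + Σ g
  Σ-+ f g = trans (reflexive (Σ≡sum (λ i → f i + g i))) (trans (S.∑-distrib-+ f g)
    (sym (+-cong (reflexive (Σ≡sum f)) (reflexive (Σ≡sum g)))))

  Σ-*ˡ : ∀ {n} (a : Carrier) (f : Fin n → Carrier) → Σ (λ i → a * f i) ≈ a * Σ f
  Σ-*ˡ a f = trans (reflexive (Σ≡sum (λ i → a * f i))) (sym (trans (*-congˡ (reflexive (Σ≡sum f))) (S.*-distribˡ-sum a f)))

  Σ-neg : ∀ {n} (f : Fin n → Carrier) → Σ (λ i → - f i) ≈ - Σ f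
  Σ-neg f = trans (Σ-cong (λ i → sym (R.-1*x≈-x (f i)))) (trans (Σ-*ˡ (- 1#) f) (R.-1*x≈-x _))

  Σ-swap : ∀ {m n} (f : Fin m → Fin n → Carrier) →
           Σ (λ i → Σ (λ j → f i j)) ≈ Σ (λ j → Σ (λ i → f i j))
  Σ-swap f = trans (Σ-cong (λ i → reflexive (Σ≡sum (f i))))
    (trans (via-sum (λ i → S.sum (f i)) (λ j → S.sum (λ i → f i j)) (S.∑-comm f)) (Σ-cong (λ j → reflexive (P.sym (Σ≡sum (λ i → f i j))))))

  Σ-reverse : ∀ {n} (f : Fin n → Carrier) → Σ f ≈ Σ (λ i → f (opposite i))
  Σ-reverse {n} f = via-sum f (λ i → f (opposite i)) (S.∑-permute f (reverse {n}))

  -- Sums over the indices satisfying a decidable predicate.  The sums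
  -- Σ< k and Σ> k of Defs are the instances "i < k" and "k < i".
  ΣWhen : ∀ {n} {Q : Fin n → Set} → (∀ i → Dec (Q i)) → (Fin n → Carrier) → Carrier
  ΣWhen Q? f = Σ (λ i → if does (Q? i) then f i else 0#)

  ΣWhen-cong : ∀ {n} {Q : Fin n → Set} (Q? : ∀ i → Dec (Q i)) {f g : Fin n → Carrier} →
               (∀ i → Q i → f i ≈ g i) → ΣWhen Q? f ≈ ΣWhen Q? g
  ΣWhen-cong Q? eq = Σ-cong (λ i → selected (Q? i) (eq i))
    where
    selected : ∀ {A : Set} {x y} (d : Dec A) → (A → x ≈ y) →
               (if does d then x else 0#) ≈ (if does d then y else 0#)
    selected (true  because [a]) x≈y = x≈y (invert [a])
    selected (false because _)   _   = refl

  if-map : ∀ b (h : Carrier → Carrier) x → h 0# ≈ 0# →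
           (if b then h x else 0#) ≈ h (if b then x else 0#)
  if-map true  h x h0 = refl
  if-map false h x h0 = sym h0

  ΣWhen-+ : ∀ {n} {Q : Fin n → Set} (Q? : ∀ i → Dec (Q i)) (f g : Fin n → Carrier) →
            ΣWhen Q? (λ i → f i + g i) ≈ ΣWhen Q? f + ΣWhen Q? g
  ΣWhen-+ Q? f g = trans (Σ-cong (λ i → split (does (Q? i))))
    (Σ-+ (λ i → if does (Q? i) then f i else 0#) (λ i → if does (Q? i) then g i else 0#))
    where
    split : ∀ b {x y} → (if b then x + y else 0#) ≈ (if b then x else 0#) + (if b then y else 0#)
    split true  = refl
    split false = sym (+-identityˡ 0#)

  ΣWhen-*ˡ : ∀ {n} {Q : Fin n → Set} (Q? : ∀ i → Dec (Q i)) a (f : Fin n → Carrier) →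
             ΣWhen Q? (λ i → a * f i) ≈ a * ΣWhen Q? f
  ΣWhen-*ˡ Q? a f = trans (Σ-cong (λ i → if-map (does (Q? i)) (a *_) (f i) (zeroʳ a))) (Σ-*ˡ a (λ i → if does (Q? i) then f i else 0#))

  ΣWhen-neg : ∀ {n} {Q : Fin n → Set} (Q? : ∀ i → Dec (Q i)) (f : Fin n → Carrier) →
              ΣWhen Q? (λ i → - f i) ≈ - ΣWhen Q? f
  ΣWhen-neg Q? f = trans (Σ-cong (λ i → if-map (does (Q? i)) -_ (f i) G.ε⁻¹≈ε)) (Σ-neg (λ i → if does (Q? i) then f i else 0#))

  ΣWhen-Σ : ∀ {n m} {Q : Fin n → Set} (Q? : ∀ i → Dec (Q i)) (f : Fin n → Fin m → Carrier) →
            ΣWhen Q? (λ i → Σ (f i)) ≈ Σ (λ t → ΣWhen Q? (λ i → f i t))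
  ΣWhen-Σ {m = m} Q? f = trans (Σ-cong (λ i → select (does (Q? i)) (f i))) (Σ-swap (λ i t → if does (Q? i) then f i t else 0#))
    where
    select : ∀ b (g : Fin m → Carrier) → (if b then Σ g else 0#) ≈ Σ (λ t → if b then g t else 0#)
    select true  g = refl
    select false g = sym (Σ-zero m)

  Σ≠ : ∀ {n} → Fin n → (Fin n → Carrier) → Carrier
  Σ≠ k f = Σ< k f + Σ> k f

  Σ≠-zero : ∀ {n} (f : Fin (suc n) → Carrier) → Σ≠ Fin.zero f ≈ Σ (λ i → f (Fin.suc i))
  Σ≠-zero {n} f = trans (+-cong (trans (+-identityˡ _) (Σ-zero n)) (+-identityˡ _)) (+-identityˡ _)

  Σ≠-suc : ∀ {n} (k : Fin n) (f : Fin (suc n) → Carrier) →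
           Σ≠ (Fin.suc k) f ≈ f Fin.zero + Σ≠ k (λ i → f (Fin.suc i))
  Σ≠-suc k f = solve 3 (λ a l u → (a :+ l) :+ (con (+ 0) :+ u) := a :+ (l :+ u)) refl
    (f Fin.zero) (Σ< k (λ i → f (Fin.suc i))) (Σ> k (λ i → f (Fin.suc i)))

  Σ-split : ∀ {n} (k : Fin n) (f : Fin n → Carrier) → Σ f ≈ f k + Σ≠ k f
  Σ-split {suc n} Fin.zero    f = +-congˡ (sym (Σ≠-zero f))
  Σ-split {suc n} (Fin.suc k) f = begin
    f₀ + Σ (λ i → f (Fin.suc i))  ≈⟨ +-congˡ (Σ-split k (λ i → f (Fin.suc i))) ⟩
    f₀ + (fₖ + R)                 ≈⟨ solve 3 (λ a b r → a :+ (b :+ r) := b :+ (a :+ r)) refl f₀ fₖ R ⟩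
    fₖ + (f₀ + R)                 ≈⟨ +-congˡ (sym (Σ≠-suc k f)) ⟩
    fₖ + Σ≠ (Fin.suc k) f         ∎
    where
    f₀ fₖ R : Carrier
    f₀ = f Fin.zero
    fₖ = f (Fin.suc k)
    R = Σ≠ k (λ i → f (Fin.suc i))

  Σ≠-cong : ∀ {n} (k : Fin n) {f g : Fin n → Carrier} → (∀ i → ¬ (i ≡ k) → f i ≈ g i) → Σ≠ k f ≈ Σ≠ k g
  Σ≠-cong k eq = +-cong
    (ΣWhen-cong (λ i → toℕ i ℕ.<? toℕ k) (λ i i<k → eq i (λ i≡k → ℕP.<-irrefl (P.cong toℕ i≡k) i<k)))
    (ΣWhen-cong (λ i → toℕ k ℕ.<? toℕ i) (λ i k<i → eq i (λ i≡k → ℕP.<-irrefl (P.cong toℕ (P.sym i≡k)) k<i)))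

  Σ≠-neg : ∀ {n} (k : Fin n) (f : Fin n → Carrier) → Σ≠ k (λ i → - f i) ≈ - Σ≠ k f
  Σ≠-neg k f = trans (+-cong (ΣWhen-neg (λ i → toℕ i ℕ.<? toℕ k) f) (ΣWhen-neg (λ i → toℕ k ℕ.<? toℕ i) f))
    (AG.⁻¹-∙-comm _ _)

  Σ-triangle : ∀ {n} (g : Fin n → Fin n → Carrier) →
               Σ (λ k → Σ> k (λ i → g k i)) ≈ Σ (λ i → Σ< i (λ k → g k i))
  Σ-triangle g = Σ-swap (λ k i → if does (toℕ k ℕ.<? toℕ i) then g k i else 0#)

  two : Carrier
  two = 1# + 1#

  -- Polynomials as coefficient lists, lowest degree first.
  Poly : Set c
  Poly = List Carrier

  ev : Poly → Carrier → Carrier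
  ev []      x = 0#
  ev (a ∷ p) x = a + x * ev p x

  coef : Poly → ℕ → Carrier
  coef []      j       = 0#
  coef (a ∷ p) zero    = a
  coef (a ∷ p) (suc j) = coef p j

  _≋_ : Poly → Poly → Set ℓ
  p ≋ q = ∀ j → coef p j ≈ coef q j

  infixl 6 _⊞_
  _⊞_ : Poly → Poly → Poly
  []      ⊞ q       = q
  (a ∷ p) ⊞ []      = a ∷ p
  (a ∷ p) ⊞ (b ∷ q) = (a + b) ∷ (p ⊞ q)

  scale : Carrier → Poly → Poly
  scale a []      = []
  scale a (b ∷ p) = a * b ∷ scale a p

  X· : Poly → Poly
  X· p = 0# ∷ p

  D′ : ℕ → Poly → Poly
  D′ k []      = []
  D′ k (a ∷ p) = ι k * a ∷ D′ (suc k) p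

  D : Poly → Poly
  D []      = []
  D (_ ∷ p) = D′ 1 p

  ev-⊞ : ∀ p q x → ev (p ⊞ q) x ≈ ev p x + ev q x
  ev-⊞ []      q       x = sym (+-identityˡ _)
  ev-⊞ (a ∷ p) []      x = sym (+-identityʳ _)
  ev-⊞ (a ∷ p) (b ∷ q) x = trans (+-congˡ (*-congˡ (ev-⊞ p q x)))
    (solve 5 (λ a b x u v → a :+ b :+ x :* (u :+ v) := a :+ x :* u :+ (b :+ x :* v)) refl a b x _ _)

  ev-scale : ∀ a p x → ev (scale a p) x ≈ a * ev p x
  ev-scale a []      x = sym (zeroʳ _)
  ev-scale a (b ∷ p) x = trans (+-congˡ (*-congˡ (ev-scale a p x)))
    (solve 4 (λ a b x u → a :* b :+ x :* (a :* u) := a :* (b :+ x :* u)) refl a b x _)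

  ev-X· : ∀ p x → ev (X· p) x ≈ x * ev p x
  ev-X· p x = +-identityˡ _

  coef-⊞ : ∀ p q j → coef (p ⊞ q) j ≈ coef p j + coef q j
  coef-⊞ []      q       j       = sym (+-identityˡ _)
  coef-⊞ (a ∷ p) []      j       = sym (+-identityʳ _)
  coef-⊞ (a ∷ p) (b ∷ q) zero    = refl
  coef-⊞ (a ∷ p) (b ∷ q) (suc j) = coef-⊞ p q j

  coef-scale : ∀ a p j → coef (scale a p) j ≈ a * coef p j
  coef-scale a []      j       = sym (zeroʳ _)
  coef-scale a (b ∷ p) zero    = refl
  coef-scale a (b ∷ p) (suc j) = coef-scale a p j

  coef-D′ : ∀ k p j → coef (D′ k p) j ≈ ι (j ℕ.+ k) * coef p j
  coef-D′ k []      j       = sym (zeroʳ _)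
  coef-D′ k (a ∷ p) zero    = refl
  coef-D′ k (a ∷ p) (suc j) = trans (coef-D′ (suc k) p j)
    (*-congʳ (reflexive (P.cong ι (ℕP.+-suc j k))))

  coef-D : ∀ p j → coef (D p) j ≈ ι (suc j) * coef p (suc j)
  coef-D []      j = sym (zeroʳ _)
  coef-D (a ∷ p) j = trans (coef-D′ 1 p j) (*-congʳ (reflexive (P.cong ι (ℕP.+-comm j 1))))

  coef-X·D : ∀ p j → coef (X· (D p)) j ≈ ι j * coef p j
  coef-X·D p zero    = sym (zeroˡ _)
  coef-X·D p (suc j) = coef-D p j

  ev-zero : ∀ p → (∀ j → coef p j ≈ 0#) → ∀ x → ev p x ≈ 0#
  ev-zero []      e x = refl
  ev-zero (a ∷ p) e x = begin
    a + x * ev p x  ≈⟨ +-cong (e zero) (*-congˡ (ev-zero p (λ j → e (suc j)) x)) ⟩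
    0# + x * 0#     ≈⟨ solve 1 (λ x → con (+ 0) :+ x :* con (+ 0) := con (+ 0)) refl x ⟩
    0#              ∎

  ≋-ev : ∀ p q → p ≋ q → ∀ x → ev p x ≈ ev q x
  ≋-ev []      q       e x = sym (ev-zero q (λ j → sym (e j)) x)
  ≋-ev (a ∷ p) []      e x = ev-zero (a ∷ p) e x
  ≋-ev (a ∷ p) (b ∷ q) e x = +-cong (e zero) (*-congˡ (≋-ev p q (λ j → e (suc j)) x))

  D-≋ : ∀ {p q} → p ≋ q → D p ≋ D q
  D-≋ {p} {q} e j = trans (coef-D p j) (trans (*-congˡ (e (suc j))) (sym (coef-D q j)))

  D-⊞ : ∀ p q → D (p ⊞ q) ≋ (D p ⊞ D q)
  D-⊞ p q j = begin
    coef (D (p ⊞ q)) j                             ≈⟨ coef-D (p ⊞ q) j ⟩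
    ι (suc j) * coef (p ⊞ q) (suc j)               ≈⟨ *-congˡ (coef-⊞ p q (suc j)) ⟩
    ι (suc j) * (coef p (suc j) + coef q (suc j))  ≈⟨ distribˡ _ _ _ ⟩
    ι (suc j) * coef p (suc j) + ι (suc j) * coef q (suc j)
                                                   ≈⟨ sym (+-cong (coef-D p j) (coef-D q j)) ⟩
    coef (D p) j + coef (D q) j                    ≈⟨ sym (coef-⊞ (D p) (D q) j) ⟩
    coef (D p ⊞ D q) j                             ∎

  mulRoot : Carrier → Poly → Poly
  mulRoot a p = X· p ⊞ scale (- a) p

  ev-mulRoot : ∀ a p x → ev (mulRoot a p) x ≈ (x - a) * ev p x
  ev-mulRoot a p x = begin
    ev (X· p ⊞ scale (- a) p) x              ≈⟨ ev-⊞ (X· p) (scale (- a) p) x ⟩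
    ev (X· p) x + ev (scale (- a) p) x       ≈⟨ +-cong (ev-X· p x) (ev-scale (- a) p x) ⟩
    x * ev p x + - a * ev p x                ≈⟨ sym (distribʳ _ _ _) ⟩
    (x - a) * ev p x                         ∎

  coef-mulRoot : ∀ a p j → coef (mulRoot a p) j ≈ coef (X· p) j + - a * coef p j
  coef-mulRoot a p j = trans (coef-⊞ (X· p) (scale (- a) p) j) (+-congˡ (coef-scale (- a) p j))

  D-mulRoot : ∀ a p → D (mulRoot a p) ≋ (p ⊞ mulRoot a (D p))
  D-mulRoot a p j = begin
    coef (D (mulRoot a p)) j                                  ≈⟨ coef-D (mulRoot a p) j ⟩
    ι (suc j) * coef (mulRoot a p) (suc j)                    ≈⟨ *-congˡ (coef-mulRoot a p (suc j)) ⟩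
    ι (suc j) * (coef p j + - a * coef p (suc j))
      ≈⟨ solve 4 (λ u a p₀ p₁ → (con (+ 1) :+ u) :* (p₀ :+ (:- a) :* p₁)
                               := p₀ :+ (u :* p₀ :+ (:- a) :* ((con (+ 1) :+ u) :* p₁))) refl (ι j) a _ _ ⟩
    coef p j + (ι j * coef p j + - a * (ι (suc j) * coef p (suc j)))
      ≈⟨ +-congˡ (sym (+-cong (coef-X·D p j) (*-congˡ (coef-D p j)))) ⟩
    coef p j + (coef (X· (D p)) j + - a * coef (D p) j)       ≈⟨ +-congˡ (sym (coef-mulRoot a (D p) j)) ⟩
    coef p j + coef (mulRoot a (D p)) j                       ≈⟨ sym (coef-⊞ p (mulRoot a (D p)) j) ⟩
    coef (p ⊞ mulRoot a (D p)) j                              ∎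

  ev-D-mulRoot : ∀ a p y → ev (D (mulRoot a p)) y ≈ ev p y + (y - a) * ev (D p) y
  ev-D-mulRoot a p y = begin
    ev (D (mulRoot a p)) y                   ≈⟨ ≋-ev (D (mulRoot a p)) (p ⊞ mulRoot a (D p)) (D-mulRoot a p) y ⟩
    ev (p ⊞ mulRoot a (D p)) y               ≈⟨ ev-⊞ p (mulRoot a (D p)) y ⟩
    ev p y + ev (mulRoot a (D p)) y          ≈⟨ +-congˡ (ev-mulRoot a (D p) y) ⟩
    ev p y + (y - a) * ev (D p) y            ∎

  ev-D²-mulRoot : ∀ a p y → ev (D (D (mulRoot a p))) y ≈ two * ev (D p) y + (y - a) * ev (D (D p)) y
  ev-D²-mulRoot a p y = begin
    ev (D (D (mulRoot a p))) y                ≈⟨ ≋-ev (D (D (mulRoot a p))) (D (p ⊞ mulRoot a (D p))) (D-≋ {D (mulRoot a p)} {p ⊞ mulRoot a (D p)} (D-mulRoot a p)) y ⟩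
    ev (D (p ⊞ mulRoot a (D p))) y            ≈⟨ ≋-ev (D (p ⊞ mulRoot a (D p))) (D p ⊞ D (mulRoot a (D p))) (D-⊞ p (mulRoot a (D p))) y ⟩
    ev (D p ⊞ D (mulRoot a (D p))) y          ≈⟨ ev-⊞ (D p) (D (mulRoot a (D p))) y ⟩
    ev (D p) y + ev (D (mulRoot a (D p))) y   ≈⟨ +-congˡ (ev-D-mulRoot a (D p) y) ⟩
    ev (D p) y + (ev (D p) y + (y - a) * ev (D (D p)) y)
      ≈⟨ solve 3 (λ d f e → d :+ (d :+ f :* e) := (con (+ 1) :+ con (+ 1)) :* d :+ f :* e) refl _ _ _ ⟩
    two * ev (D p) y + (y - a) * ev (D (D p)) y ∎

  rootPoly : ∀ {m} → (Fin m → Carrier) → Poly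
  rootPoly {zero}  z = 1# ∷ []
  rootPoly {suc m} z = mulRoot (z Fin.zero) (rootPoly (λ i → z (Fin.suc i)))

  ev-rootPoly : ∀ {m} (z : Fin m → Carrier) x → ev (rootPoly z) x ≈ Π (λ i → x - z i)
  ev-rootPoly {zero}  z x = trans (+-congˡ (zeroʳ x)) (+-identityʳ _)
  ev-rootPoly {suc m} z x = trans (ev-mulRoot (z Fin.zero) (rootPoly (λ i → z (Fin.suc i))) x)
    (*-congˡ (ev-rootPoly (λ i → z (Fin.suc i)) x))

  log-derivative : ∀ {m} (z : Fin m → Carrier) y → (∀ i → ¬ (y ≈ z i)) →
                   ¬ (ev (rootPoly z) y ≈ 0#)
                   × ev (D (rootPoly z)) y ≈ ev (rootPoly z) y * Σ (λ i → (y - z i) ⁻¹)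
  log-derivative {zero} z y y≉z = one≉0 , sym (zeroʳ _)
    where
    one≉0 : ¬ (1# + y * 0# ≈ 0#)
    one≉0 e = 0≉1 (sym (trans (sym (trans (+-congˡ (zeroʳ y)) (+-identityʳ 1#))) e))
  log-derivative {suc m} z y y≉z = P≉0 , (begin
    ev (D P) y                ≈⟨ ev-D-mulRoot a Q y ⟩
    q + f * ev (D Q) y        ≈⟨ +-congˡ (*-congˡ Q′≈) ⟩
    q + f * (q * S)
      ≈⟨ solve 4 (λ f fi q s → q :+ f :* (q :* s) := (f :* q) :* (fi :+ s) :- q :* (f :* fi :- con (+ 1))) refl f (f ⁻¹) q S ⟩
    (f * q) * (f ⁻¹ + S) - q * (f * f ⁻¹ - 1#)
      ≈⟨ +-congˡ (-‿cong (*-congˡ (trans (+-congʳ (inverse f f≉0)) (-‿inverseʳ 1#)))) ⟩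
    (f * q) * (f ⁻¹ + S) - q * 0#
      ≈⟨ trans (+-congˡ (trans (-‿cong (zeroʳ _)) G.ε⁻¹≈ε)) (+-identityʳ _) ⟩
    (f * q) * (f ⁻¹ + S)      ≈⟨ *-congʳ (sym (ev-mulRoot a Q y)) ⟩
    ev P y * (f ⁻¹ + S)       ∎)
    where
    a f q S : Carrier
    a = z Fin.zero
    f = y - a
    Q P : Poly
    Q = rootPoly (λ i → z (Fin.suc i))
    P = mulRoot a Q
    q = ev Q y
    S = Σ (λ i → (y - z (Fin.suc i)) ⁻¹)
    f≉0 : ¬ (f ≈ 0#)
    f≉0 = nonzero-difference (y≉z Fin.zero)
    q≉0 : ¬ (q ≈ 0#)
    q≉0 = proj₁ (log-derivative (λ i → z (Fin.suc i)) y (λ i → y≉z (Fin.suc i)))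
    Q′≈ : ev (D Q) y ≈ q * S
    Q′≈ = proj₂ (log-derivative (λ i → z (Fin.suc i)) y (λ i → y≉z (Fin.suc i)))
    P≉0 : ¬ (ev P y ≈ 0#)
    P≉0 e = nonzero-* f≉0 q≉0 (trans (sym (ev-mulRoot a Q y)) e)

  Distinct : ∀ {m} → (Fin m → Carrier) → Set ℓ
  Distinct z = ∀ i j → ¬ (i ≡ j) → ¬ (z i ≈ z j)

  at-root : ∀ {m} (z : Fin m → Carrier) → Distinct z → (k : Fin m) →
            ev (rootPoly z) (z k) ≈ 0#
            × ¬ (ev (D (rootPoly z)) (z k) ≈ 0#)
            × ev (D (D (rootPoly z))) (z k) ≈ two * ev (D (rootPoly z)) (z k) * Σ≠ k (λ i → (z k - z i) ⁻¹)
  -- k = 0: P = (X - a) Q with Q(a) ≠ 0, so P′(a) = Q(a) and P″(a) = 2 Q′(a)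
  at-root {suc m} z distinct Fin.zero = P≈0 , P′≉0 , P″≈
    where
    a S : Carrier
    a = z Fin.zero
    S = Σ (λ i → (a - z (Fin.suc i)) ⁻¹)
    Q : Poly
    Q = rootPoly (λ i → z (Fin.suc i))
    a≉zᵢ : ∀ i → ¬ (a ≈ z (Fin.suc i))
    a≉zᵢ i e = distinct (Fin.suc i) Fin.zero (λ ()) (sym e)
    killed : ∀ x → (a - a) * x ≈ 0#
    killed x = trans (*-congʳ (-‿inverseʳ a)) (zeroˡ x)
    P≈0 : ev (mulRoot a Q) a ≈ 0#
    P≈0 = trans (ev-mulRoot a Q a) (killed _)
    P′≈Q : ev (D (mulRoot a Q)) a ≈ ev Q a
    P′≈Q = trans (ev-D-mulRoot a Q a) (trans (+-congˡ (killed _)) (+-identityʳ _))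
    P′≉0 : ¬ (ev (D (mulRoot a Q)) a ≈ 0#)
    P′≉0 e = proj₁ (log-derivative (λ i → z (Fin.suc i)) a a≉zᵢ) (trans (sym P′≈Q) e)
    P″≈ : ev (D (D (mulRoot a Q))) a ≈ two * ev (D (mulRoot a Q)) a * Σ≠ Fin.zero (λ i → (a - z i) ⁻¹)
    P″≈ = begin
      ev (D (D (mulRoot a Q))) a                 ≈⟨ ev-D²-mulRoot a Q a ⟩
      two * ev (D Q) a + (a - a) * ev (D (D Q)) a ≈⟨ trans (+-congˡ (killed _)) (+-identityʳ _) ⟩
      two * ev (D Q) a                           ≈⟨ *-congˡ (proj₂ (log-derivative (λ i → z (Fin.suc i)) a a≉zᵢ)) ⟩
      two * (ev Q a * S)                         ≈⟨ sym (*-assoc _ _ _) ⟩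
      two * ev Q a * S                           ≈⟨ *-cong (*-congˡ (sym P′≈Q)) (sym (Σ≠-zero (λ i → (a - z i) ⁻¹))) ⟩
      two * ev (D (mulRoot a Q)) a * Σ≠ Fin.zero (λ i → (a - z i) ⁻¹) ∎
  -- k = k′ + 1: P = (X - a) Q with Q(y) = 0, so P′(y) = (y - a) Q′(y) and
  -- P″(y) = 2 Q′(y) + (y - a) Q″(y); the first term supplies the summand i = 0
  at-root {suc m} z distinct (Fin.suc k) = P≈0 , P′≉0 , P″≈
    where
    a y f S : Carrier
    a = z Fin.zero
    y = z (Fin.suc k)
    f = y - a
    S = Σ≠ k (λ i → (y - z (Fin.suc i)) ⁻¹)
    Q : Poly
    Q = rootPoly (λ i → z (Fin.suc i))
    f≉0 : ¬ (f ≈ 0#)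
    f≉0 = nonzero-difference (distinct (Fin.suc k) Fin.zero (λ ()))
    IH : ev Q y ≈ 0# × ¬ (ev (D Q) y ≈ 0#) × ev (D (D Q)) y ≈ two * ev (D Q) y * S
    IH = at-root (λ i → z (Fin.suc i)) (λ i j i≢j → distinct (Fin.suc i) (Fin.suc j) (λ e → i≢j (FinP.suc-injective e))) k
    P′≈ : ev (D (mulRoot a Q)) y ≈ f * ev (D Q) y
    P′≈ = trans (ev-D-mulRoot a Q y) (trans (+-congʳ (proj₁ IH)) (+-identityˡ _))
    P≈0 : ev (mulRoot a Q) y ≈ 0#
    P≈0 = trans (ev-mulRoot a Q y) (trans (*-congˡ (proj₁ IH)) (zeroʳ f))
    P′≉0 : ¬ (ev (D (mulRoot a Q)) y ≈ 0#)
    P′≉0 e = nonzero-* f≉0 (proj₁ (proj₂ IH)) (trans (sym P′≈) e)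
    P″≈ : ev (D (D (mulRoot a Q))) y ≈ two * ev (D (mulRoot a Q)) y * Σ≠ (Fin.suc k) (λ i → (y - z i) ⁻¹)
    P″≈ = begin
      ev (D (D (mulRoot a Q))) y                  ≈⟨ ev-D²-mulRoot a Q y ⟩
      two * ev (D Q) y + f * ev (D (D Q)) y       ≈⟨ +-congˡ (*-congˡ (proj₂ (proj₂ IH))) ⟩
      two * ev (D Q) y + f * (two * ev (D Q) y * S)
        ≈⟨ solve 4 (λ f fi d s → (con (+ 1) :+ con (+ 1)) :* d :+ f :* ((con (+ 1) :+ con (+ 1)) :* d :* s)
                     := (con (+ 1) :+ con (+ 1)) :* (f :* d) :* (fi :+ s) :- (con (+ 1) :+ con (+ 1)) :* d :* (f :* fi :- con (+ 1)))
                refl f (f ⁻¹) (ev (D Q) y) S ⟩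
      two * (f * ev (D Q) y) * (f ⁻¹ + S) - two * ev (D Q) y * (f * f ⁻¹ - 1#)
        ≈⟨ +-congˡ (-‿cong (*-congˡ (trans (+-congʳ (inverse f f≉0)) (-‿inverseʳ 1#)))) ⟩
      two * (f * ev (D Q) y) * (f ⁻¹ + S) - two * ev (D Q) y * 0#
        ≈⟨ trans (+-congˡ (trans (-‿cong (zeroʳ _)) G.ε⁻¹≈ε)) (+-identityʳ _) ⟩
      two * (f * ev (D Q) y) * (f ⁻¹ + S)
        ≈⟨ *-cong (*-congˡ (sym P′≈)) (sym (Σ≠-suc k (λ i → (y - z i) ⁻¹))) ⟩
      two * ev (D (mulRoot a Q)) y * Σ≠ (Fin.suc k) (λ i → (y - z i) ⁻¹) ∎

  quotient : Carrier → Poly → Poly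
  quotient b []      = []
  quotient b (a ∷ p) = ev (a ∷ p) b ∷ quotient b p

  length-quotient : ∀ b p → length (quotient b p) ≡ length p
  length-quotient b []      = P.refl
  length-quotient b (a ∷ p) = P.cong suc (length-quotient b p)

  division : ∀ b a p x → ev (a ∷ p) x ≈ ev (a ∷ p) b + (x - b) * ev (quotient b p) x
  division b a []      x = solve 3 (λ a b x → a :+ x :* con (+ 0) := (a :+ b :* con (+ 0)) :+ (x :- b) :* con (+ 0)) refl a b x
  division b a (d ∷ p) x = begin
    a + x * ev (d ∷ p) x        ≈⟨ +-congˡ (*-congˡ (division b d p x)) ⟩
    a + x * (E + (x - b) * Q)   ≈⟨ solve 5 (λ a x b E Q → a :+ x :* (E :+ (x :- b) :* Q) := (a :+ b :* E) :+ (x :- b) :* (E :+ x :* Q)) refl a x b E Q ⟩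
    (a + b * E) + (x - b) * (E + x * Q) ∎
    where
    E Q : Carrier
    E = ev (d ∷ p) b
    Q = ev (quotient b p) x

  -- a polynomial vanishing at infinitely many distinct points vanishes
  -- everywhere (induction on the length, dividing out X - a 0)
  vanishes-everywhere : ∀ N p → length p ≡ N → (a : ℕ → Carrier) →
                        (∀ i j → ¬ (i ≡ j) → ¬ (a i ≈ a j)) →
                        (∀ i → ev p (a i) ≈ 0#) → ∀ x → ev p x ≈ 0#
  vanishes-everywhere N       []      _      a a-distinct p≈0 x = refl
  vanishes-everywhere (suc N) (c ∷ p) P.refl a a-distinct p≈0 x = begin
    ev (c ∷ p) x                              ≈⟨ division (a 0) c p x ⟩
    ev (c ∷ p) (a 0) + (x - a 0) * ev q x
      ≈⟨ +-cong (p≈0 0) (*-congˡ (vanishes-everywhere N q (length-quotient (a 0) p) (λ i → a (suc i))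
           (λ i j i≢j → a-distinct (suc i) (suc j) (λ e → i≢j (ℕP.suc-injective e))) q≈0-at x)) ⟩
    0# + (x - a 0) * 0#                       ≈⟨ solve 2 (λ x y → con (+ 0) :+ (x :- y) :* con (+ 0) := con (+ 0)) refl x (a 0) ⟩
    0#                                        ∎
    where
    q : Poly
    q = quotient (a 0) p
    q≈0-at : ∀ i → ev q (a (suc i)) ≈ 0#
    q≈0-at i = zero-product (nonzero-difference (a-distinct (suc i) 0 (λ ()))) (begin
      (a (suc i) - a 0) * ev q (a (suc i))               ≈⟨ sym (+-identityˡ _) ⟩
      0# + (a (suc i) - a 0) * ev q (a (suc i))          ≈⟨ +-congʳ (sym (p≈0 0)) ⟩
      ev (c ∷ p) (a 0) + (a (suc i) - a 0) * ev q (a (suc i)) ≈⟨ sym (division (a 0) c p (a (suc i))) ⟩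
      ev (c ∷ p) (a (suc i))                             ≈⟨ p≈0 (suc i) ⟩
      0#                                                 ∎)

  module IdentityTheorem (pt : ℕ → Carrier) (pt-distinct : ∀ i j → ¬ (i ≡ j) → ¬ (pt i ≈ pt j))
                       (pt-nonzero : ∀ i → ¬ (pt i ≈ 0#)) where

    zero-coefficients : ∀ p → (∀ x → ev p x ≈ 0#) → ∀ j → coef p j ≈ 0#
    zero-coefficients []      p≈0 j       = refl
    zero-coefficients (c ∷ p) p≈0 zero    = constant-term p p≈0
      where
      constant-term : ∀ p → (∀ x → ev (c ∷ p) x ≈ 0#) → c ≈ 0#
      constant-term p p≈0 = trans (solve 2 (λ c e → c := c :+ con (+ 0) :* e) refl c (ev p 0#)) (p≈0 0#)
    zero-coefficients (c ∷ p) p≈0 (suc j) =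
      zero-coefficients p (vanishes-everywhere (length p) p P.refl pt pt-distinct tail≈0) j
      where
      tail≈0 : ∀ i → ev p (pt i) ≈ 0#
      tail≈0 i = zero-product (pt-nonzero i) (begin
        pt i * ev p (pt i)        ≈⟨ sym (+-identityˡ _) ⟩
        0# + pt i * ev p (pt i)   ≈⟨ +-congʳ (sym (zero-coefficients (c ∷ p) p≈0 zero)) ⟩
        ev (c ∷ p) (pt i)         ≈⟨ p≈0 (pt i) ⟩
        0#                        ∎)

    polynomial-identity : ∀ p q → (∀ i → ev p (pt i) ≈ ev q (pt i)) → p ≋ q
    polynomial-identity p q p≈q j = begin
      coef p j                                  ≈⟨ solve 2 (λ u v → u := (u :+ (con (-[1+ 0 ]) :* v)) :+ v) refl _ _ ⟩
      (coef p j + - 1# * coef q j) + coef q j   ≈⟨ +-congʳ (+-congˡ (sym (coef-scale (- 1#) q j))) ⟩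
      (coef p j + coef (scale (- 1#) q) j) + coef q j ≈⟨ +-congʳ (sym (coef-⊞ p (scale (- 1#) q) j)) ⟩
      coef d j + coef q j                       ≈⟨ +-congʳ (zero-coefficients d (vanishes-everywhere (length d) d P.refl pt pt-distinct d≈0) j) ⟩
      0# + coef q j                             ≈⟨ +-identityˡ _ ⟩
      coef q j                                  ∎
      where
      d : Poly
      d = p ⊞ scale (- 1#) q
      d≈0 : ∀ i → ev d (pt i) ≈ 0#
      d≈0 i = begin
        ev d (pt i)                               ≈⟨ ev-⊞ p (scale (- 1#) q) (pt i) ⟩
        ev p (pt i) + ev (scale (- 1#) q) (pt i)  ≈⟨ +-cong (p≈q i) (ev-scale (- 1#) q (pt i)) ⟩
        ev q (pt i) + - 1# * ev q (pt i)          ≈⟨ solve 1 (λ u → u :+ con (-[1+ 0 ]) :* u := con (+ 0)) refl _ ⟩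
        0#                                        ∎

  ev-applyUpTo : ∀ (f : ℕ → Carrier) r x → ev (applyUpTo f r) x ≈ Σ {r} (λ j → f (toℕ j) * x ^ℕ toℕ j)
  ev-applyUpTo f zero    x = refl
  ev-applyUpTo f (suc r) x = begin
    f 0 + x * ev (applyUpTo (λ j → f (suc j)) r) x
      ≈⟨ +-cong (sym (*-identityʳ _)) (*-congˡ (ev-applyUpTo (λ j → f (suc j)) r x)) ⟩
    f 0 * 1# + x * Σ {r} (λ j → f (suc (toℕ j)) * x ^ℕ toℕ j)
      ≈⟨ +-congˡ (sym (Σ-*ˡ {r} x (λ j → f (suc (toℕ j)) * x ^ℕ toℕ j))) ⟩
    f 0 * 1# + Σ {r} (λ j → x * (f (suc (toℕ j)) * x ^ℕ toℕ j))
      ≈⟨ +-congˡ (Σ-cong {r} (λ j → solve 3 (λ x a p → x :* (a :* p) := a :* (x :* p)) refl x (f (suc (toℕ j))) (x ^ℕ toℕ j))) ⟩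
    f 0 * 1# + Σ {r} (λ j → f (suc (toℕ j)) * (x * x ^ℕ toℕ j)) ∎

  coef-applyUpTo-< : ∀ (f : ℕ → Carrier) r j → j ℕ.< r → coef (applyUpTo f r) j ≡ f j
  coef-applyUpTo-< f (suc r) zero    _           = P.refl
  coef-applyUpTo-< f (suc r) (suc j) (ℕ.s≤s j<r) = coef-applyUpTo-< (λ i → f (suc i)) r j j<r

  coef-applyUpTo-≥ : ∀ (f : ℕ → Carrier) r j → r ≤ j → coef (applyUpTo f r) j ≡ 0#
  coef-applyUpTo-≥ f zero    j       _           = P.refl
  coef-applyUpTo-≥ f (suc r) (suc j) (ℕ.s≤s r≤j) = coef-applyUpTo-≥ (λ i → f (suc i)) r j r≤j

  besselTerm : ℕ → ℕ → Carrier
  besselTerm n m = ι ((n ℕ.+ m) !) / ι (besselDenominator n m)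

  besselPoly : ℕ → Poly
  besselPoly n = applyUpTo (λ j → besselTerm n (n ℕ.∸ j)) (suc n)

  -- reversing the order of summation m ↦ n - m turns θ n into besselPoly n
  θ≈besselPoly : ∀ n x → θ n x ≈ ev (besselPoly n) x
  θ≈besselPoly n x = begin
    θ n x                                                      ≈⟨ Σ-reverse {suc n} (λ m → term (toℕ m)) ⟩
    Σ {suc n} (λ j → term (toℕ (opposite j)))                  ≈⟨ Σ-cong reindex ⟩
    Σ {suc n} (λ j → besselTerm n (n ℕ.∸ toℕ j) * x ^ℕ toℕ j)
      ≈⟨ sym (ev-applyUpTo (λ j → besselTerm n (n ℕ.∸ j)) (suc n) x) ⟩
    ev (besselPoly n) x                                        ∎
    where
    term : ℕ → Carrier
    term m = besselTerm n m * x ^ℕ (n ℕ.∸ m)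
    reindex : ∀ (j : Fin (suc n)) → term (toℕ (opposite j)) ≈ besselTerm n (n ℕ.∸ toℕ j) * x ^ℕ toℕ j
    reindex j rewrite FinP.opposite-prop j
                    | ℕP.m∸[m∸n]≡n (ℕP.≤-pred (FinP.toℕ<n j)) = refl

  driftTerm : ℕ → Poly → Poly
  driftTerm n p = X· (D p) ⊞ scale (ι n) (D p)

  -- p ↦ X p″ − 2 (X + n) p′ + 2 n p, the differential operator of the
  -- Bessel equation x θ″ − 2 (x + n) θ′ + 2 n θ = 0
  besselOp : ℕ → Poly → Poly
  besselOp n p = X· (D (D p)) ⊞ (scale (- two) (driftTerm n p) ⊞ scale (two * ι n) p)

  ev-besselOp : ∀ n p x → ev (besselOp n p) x ≈
                x * ev (D (D p)) x + (- two * (x * ev (D p) x + ι n * ev (D p) x) + two * ι n * ev p x)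
  ev-besselOp n p x = begin
    ev (besselOp n p) x
      ≈⟨ ev-⊞ (X· (D (D p))) (scale (- two) (driftTerm n p) ⊞ scale (two * ι n) p) x ⟩
    ev (X· (D (D p))) x + ev (scale (- two) (driftTerm n p) ⊞ scale (two * ι n) p) x
      ≈⟨ +-cong (ev-X· (D (D p)) x) (ev-⊞ (scale (- two) (driftTerm n p)) (scale (two * ι n) p) x) ⟩
    x * ev (D (D p)) x + (ev (scale (- two) (driftTerm n p)) x + ev (scale (two * ι n) p) x)
      ≈⟨ +-congˡ (+-cong (ev-scale (- two) (driftTerm n p) x) (ev-scale (two * ι n) p x)) ⟩
    x * ev (D (D p)) x + (- two * ev (driftTerm n p) x + two * ι n * ev p x)
      ≈⟨ +-congˡ (+-congʳ (*-congˡ (trans (ev-⊞ (X· (D p)) (scale (ι n) (D p)) x)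
                                           (+-cong (ev-X· (D p) x) (ev-scale (ι n) (D p) x))))) ⟩
    x * ev (D (D p)) x + (- two * (x * ev (D p) x + ι n * ev (D p) x) + two * ι n * ev p x) ∎

  coef-besselOp : ∀ n p j → coef (besselOp n p) j ≈
                  ι (suc j) * (ι j - two * ι n) * coef p (suc j) + two * (ι n - ι j) * coef p j
  coef-besselOp n p j = begin
    coef (besselOp n p) j
      ≈⟨ coef-⊞ (X· (D (D p))) (scale (- two) (driftTerm n p) ⊞ scale (two * ι n) p) j ⟩
    coef (X· (D (D p))) j + coef (scale (- two) (driftTerm n p) ⊞ scale (two * ι n) p) j
      ≈⟨ +-congˡ (coef-⊞ (scale (- two) (driftTerm n p)) (scale (two * ι n) p) j) ⟩
    coef (X· (D (D p))) j + (coef (scale (- two) (driftTerm n p)) j + coef (scale (two * ι n) p) j)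
      ≈⟨ +-congˡ (+-cong (coef-scale (- two) (driftTerm n p) j) (coef-scale (two * ι n) p j)) ⟩
    coef (X· (D (D p))) j + (- two * coef (driftTerm n p) j + two * ι n * coef p j)
      ≈⟨ +-cong (trans (coef-X·D (D p) j) (*-congˡ (coef-D p j)))
                (+-congʳ (*-congˡ (trans (coef-⊞ (X· (D p)) (scale (ι n) (D p)) j)
                  (+-cong (coef-X·D p j) (trans (coef-scale (ι n) (D p) j) (*-congˡ (coef-D p j))))))) ⟩
    ι j * (ι (suc j) * coef p (suc j)) + (- two * (ι j * coef p j + ι n * (ι (suc j) * coef p (suc j))) + two * ι n * coef p j)
      ≈⟨ solve 4 (λ u N p₀ p₁ →
           u :* ((con (+ 1) :+ u) :* p₁) :+ ((:- (con (+ 1) :+ con (+ 1))) :* (u :* p₀ :+ N :* ((con (+ 1) :+ u) :* p₁))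
              :+ (con (+ 1) :+ con (+ 1)) :* N :* p₀)
           := (con (+ 1) :+ u) :* (u :- (con (+ 1) :+ con (+ 1)) :* N) :* p₁ :+ (con (+ 1) :+ con (+ 1)) :* (N :- u) :* p₀)
           refl (ι j) (ι n) (coef p j) (coef p (suc j)) ⟩
    ι (suc j) * (ι j - two * ι n) * coef p (suc j) + two * (ι n - ι j) * coef p j ∎

  besselOp-≋ : ∀ n {p q} → p ≋ q → besselOp n p ≋ besselOp n q
  besselOp-≋ n {p} {q} e j = trans (coef-besselOp n p j)
    (trans (+-cong (*-congˡ (e (suc j))) (*-congˡ (e j))) (sym (coef-besselOp n q j)))

  ^-+ : ∀ x a b → x ^ℕ (a ℕ.+ b) ≈ x ^ℕ a * x ^ℕ b
  ^-+ x zero    b = sym (*-identityˡ _)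
  ^-+ x (suc a) b = trans (*-congˡ (^-+ x a b)) (sym (*-assoc _ _ _))

  ⁻¹*^ℤ : ∀ x r → ¬ (x ≈ 0#) → x ⁻¹ * x ^ℤ r ≈ x ^ℤ (r ℤ.- + 1)
  ⁻¹*^ℤ x (+ zero)  x≉0 = refl
  ⁻¹*^ℤ x (+ suc q) x≉0 = trans (sym (*-assoc _ _ _)) (trans (*-congʳ (inverseˡ x≉0)) (*-identityˡ _))
  ⁻¹*^ℤ x -[1+ q ]  x≉0 = reflexive (P.cong (λ e → (x ⁻¹) ^ℕ suc (suc e)) (P.sym (ℕP.+-identityʳ q)))

  ^ℤ-neg : ∀ x q → x ^ℤ (ℤ.- (+ q)) ≡ (x ⁻¹) ^ℕ q
  ^ℤ-neg x zero    = P.refl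
  ^ℤ-neg x (suc q) = P.refl

  -- H m u v = Σ_{t<m} u^(t+1) v^(m-t), the quotient u v (u^m - v^m)/(u - v)
  H : ℕ → Carrier → Carrier → Carrier
  H m u v = Σ {m} (λ t → u ^ℕ suc (toℕ t) * v ^ℕ (m ℕ.∸ toℕ t))

  geometric-sum : ∀ m u v → (u - v) * H m u v ≈ u * v * (u ^ℕ m - v ^ℕ m)
  geometric-sum zero    u v = solve 2 (λ u v → (u :- v) :* con (+ 0) := u :* v :* (con (+ 1) :- con (+ 1))) refl u v
  geometric-sum (suc m) u v = begin
    (u - v) * H (suc m) u v                             ≈⟨ *-congˡ H-suc ⟩
    (u - v) * (u * (v * v ^ℕ m) + u * H m u v)
      ≈⟨ solve 4 (λ u v vm h → (u :- v) :* (u :* (v :* vm) :+ u :* h) := (u :- v) :* (u :* (v :* vm)) :+ u :* ((u :- v) :* h)) refl u v (v ^ℕ m) (H m u v) ⟩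
    (u - v) * (u * (v * v ^ℕ m)) + u * ((u - v) * H m u v)
                                                        ≈⟨ +-congˡ (*-congˡ (geometric-sum m u v)) ⟩
    (u - v) * (u * (v * v ^ℕ m)) + u * (u * v * (u ^ℕ m - v ^ℕ m))
      ≈⟨ solve 4 (λ u v um vm → (u :- v) :* (u :* (v :* vm)) :+ u :* (u :* v :* (um :- vm)) := u :* v :* (u :* um :- v :* vm)) refl u v (u ^ℕ m) (v ^ℕ m) ⟩
    u * v * (u * u ^ℕ m - v * v ^ℕ m)                   ∎
    where
    H-suc : H (suc m) u v ≈ u * (v * v ^ℕ m) + u * H m u v
    H-suc = +-cong (*-congʳ (*-identityʳ u))
      (trans (Σ-cong {m} (λ t → *-assoc u _ _)) (Σ-*ˡ {m} u (λ t → u ^ℕ suc (toℕ t) * v ^ℕ (m ℕ.∸ toℕ t))))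

  -- symmetrising 1/(zᵢ - z_k) against the weights z^(-m):
  -- z_k^(-m)/(zᵢ - z_k) + zᵢ^(-m)/(z_k - zᵢ) = H m (1/z_k) (1/zᵢ)
  symmetrised-pair : ∀ {zi zk} m → ¬ (zi ≈ 0#) → ¬ (zk ≈ 0#) → ¬ (zi ≈ zk) →
         (zk ⁻¹) ^ℕ m * (zi - zk) ⁻¹ + (zi ⁻¹) ^ℕ m * (zk - zi) ⁻¹ ≈ H m (zk ⁻¹) (zi ⁻¹)
  symmetrised-pair {zi} {zk} m zi≉0 zk≉0 zi≉zk = cancelˡ (nonzero-* (nonzero-⁻¹ zk≉0) (nonzero-⁻¹ zi≉0)) (begin
    u * v * (u ^ℕ m * d + v ^ℕ m * (zk - zi) ⁻¹)     ≈⟨ *-congˡ (+-congˡ (*-congˡ (inverse-swap zi≉zk))) ⟩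
    u * v * (u ^ℕ m * d + v ^ℕ m * (- d))
      ≈⟨ solve 5 (λ u v um vm d → u :* v :* (um :* d :+ vm :* (:- d)) := (u :* v :* (um :- vm)) :* d) refl u v (u ^ℕ m) (v ^ℕ m) d ⟩
    (u * v * (u ^ℕ m - v ^ℕ m)) * d                   ≈⟨ *-congʳ (sym (geometric-sum m u v)) ⟩
    ((u - v) * H m u v) * d                           ≈⟨ *-congʳ (*-congʳ (sym u-v≈)) ⟩
    ((u * v * (zi - zk)) * H m u v) * d
      ≈⟨ solve 6 (λ u v zi zk h d → ((u :* v :* (zi :- zk)) :* h) :* d := u :* v :* h :* ((zi :- zk) :* d)) refl u v zi zk (H m u v) d ⟩
    u * v * H m u v * ((zi - zk) * d)                 ≈⟨ *-congˡ (inverse _ (nonzero-difference zi≉zk)) ⟩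
    u * v * H m u v * 1#                              ≈⟨ *-identityʳ _ ⟩
    u * v * H m u v                                   ∎)
    where
    u v d : Carrier
    u = zk ⁻¹
    v = zi ⁻¹
    d = (zi - zk) ⁻¹
    u-v≈ : u * v * (zi - zk) ≈ u - v
    u-v≈ = begin
      u * v * (zi - zk)            ≈⟨ solve 4 (λ u v zi zk → u :* v :* (zi :- zk) := u :* (v :* zi) :- v :* (u :* zk)) refl u v zi zk ⟩
      u * (v * zi) - v * (u * zk)  ≈⟨ +-cong (*-congˡ (inverseˡ zi≉0)) (-‿cong (*-congˡ (inverseˡ zk≉0))) ⟩
      u * 1# - v * 1#              ≈⟨ +-cong (*-identityʳ u) (-‿cong (*-identityʳ v)) ⟩
      u - v                        ∎

  module PowerSums {n} (z : Fin n → Carrier) (nonzero : ∀ i → ¬ (z i ≈ 0#)) (distinct : Distinct z)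
                   (c : Carrier) (relation : ∀ k → Σ≠ k (λ i → (z i - z k) ⁻¹) ≈ - 1# - c * z k ⁻¹) where
    open Zeta z

    w : Fin n → Carrier
    w i = z i ⁻¹

    ζℕ : ℕ → Carrier
    ζℕ m = Σ (λ j → w j ^ℕ m)

    ζ₂ℕ : ℕ → ℕ → Carrier
    ζ₂ℕ a b = Σ (λ i → Σ< i (λ j → w i ^ℕ a * w j ^ℕ b))

    ζ≈ζℕ : ∀ q → ζ (+ q) ≈ ζℕ q
    ζ≈ζℕ q = Σ-cong (λ j → reflexive (^ℤ-neg (z j) q))

    ζ₂≈ζ₂ℕ : ∀ a b → ζ₂ (+ a) (+ b) ≈ ζ₂ℕ a b
    ζ₂≈ζ₂ℕ a b = Σ-cong (λ i → ΣWhen-cong (λ j → toℕ j ℕ.<? toℕ i)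
      (λ j _ → *-cong (reflexive (^ℤ-neg (z i) a)) (reflexive (^ℤ-neg (z j) b))))

    invZt≈ : ∀ k → invZt k ≈ - 1# - c * z k ⁻¹ - Σ> k w
    invZt≈ k = begin
      invZt k
        ≈⟨ +-congˡ (trans (ΣWhen-+ (λ i → toℕ k ℕ.<? toℕ i) (λ i → (z i - z k) ⁻¹) (λ i → - w i))
                          (+-congˡ (ΣWhen-neg (λ i → toℕ k ℕ.<? toℕ i) w))) ⟩
      Σ< k (λ i → (z i - z k) ⁻¹) + (Σ> k (λ i → (z i - z k) ⁻¹) - Σ> k w)
        ≈⟨ sym (+-assoc _ _ _) ⟩
      Σ≠ k (λ i → (z i - z k) ⁻¹) - Σ> k w
        ≈⟨ +-congʳ (relation k) ⟩
      - 1# - c * z k ⁻¹ - Σ> k w ∎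

    ζ̃≈ : ∀ s → ζ̃ s ≈ (- c) * ζ s - ζ (s ℤ.- + 1) - ζ₂ (+ 1) (s ℤ.- + 1)
    ζ̃≈ s = begin
      ζ̃ s                                                     ≈⟨ Σ-cong (λ k → trans (*-congʳ (invZt≈ k)) (summand k)) ⟩
      Σ (λ k → - e k + (- (c * e′ k) + - (e k * Σ> k w)))    ≈⟨ trans (Σ-+ (λ k → - e k) (λ k → - (c * e′ k) + - (e k * Σ> k w)))
                (+-congˡ (Σ-+ (λ k → - (c * e′ k)) (λ k → - (e k * Σ> k w)))) ⟩
      Σ (λ k → - e k) + (Σ (λ k → - (c * e′ k)) + Σ (λ k → - (e k * Σ> k w)))
        ≈⟨ +-cong (Σ-neg e) (+-cong (trans (Σ-neg (λ k → c * e′ k)) (-‿cong (Σ-*ˡ c e′))) (Σ-neg (λ k → e k * Σ> k w))) ⟩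
      - ζ (s ℤ.- + 1) + (- (c * ζ s) + - Σ (λ k → e k * Σ> k w))
        ≈⟨ +-congˡ (+-congˡ (-‿cong triangle)) ⟩
      - ζ (s ℤ.- + 1) + (- (c * ζ s) + - ζ₂ (+ 1) (s ℤ.- + 1))
        ≈⟨ solve 4 (λ a b d c → :- a :+ (:- (c :* b) :+ :- d) := (:- c) :* b :- a :- d) refl _ _ _ c ⟩
      (- c) * ζ s - ζ (s ℤ.- + 1) - ζ₂ (+ 1) (s ℤ.- + 1)     ∎
      where
      e e′ : Fin n → Carrier
      e k = z k ^ℤ (ℤ.- (s ℤ.- + 1))
      e′ k = z k ^ℤ (ℤ.- s)
      w*e≈e′ : ∀ k → w k * e k ≈ e′ k
      w*e≈e′ k = trans (⁻¹*^ℤ (z k) (ℤ.- (s ℤ.- + 1)) (nonzero k)) (reflexive (P.cong (z k ^ℤ_) (exponent-step s)))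
      summand : ∀ k → (- 1# - c * w k - Σ> k w) * e k ≈ - e k + (- (c * e′ k) + - (e k * Σ> k w))
      summand k = trans
        (solve 5 (λ ek c wk S e′ → (:- con (+ 1) :- c :* wk :- S) :* ek := :- ek :+ (:- (c :* (wk :* ek)) :+ :- (ek :* S))) refl (e k) c (w k) (Σ> k w) (e′ k))
        (+-congˡ (+-congʳ (-‿cong (*-congˡ (w*e≈e′ k)))))
      triangle : Σ (λ k → e k * Σ> k w) ≈ ζ₂ (+ 1) (s ℤ.- + 1)
      triangle = begin
        Σ (λ k → e k * Σ> k w)                  ≈⟨ Σ-cong (λ k → sym (ΣWhen-*ˡ (λ i → toℕ k ℕ.<? toℕ i) (e k) w)) ⟩
        Σ (λ k → Σ> k (λ i → e k * w i))        ≈⟨ Σ-triangle (λ k i → e k * w i) ⟩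
        Σ (λ i → Σ< i (λ k → e k * w i))
          ≈⟨ Σ-cong (λ i → ΣWhen-cong (λ k → toℕ k ℕ.<? toℕ i) (λ k _ → solve 2 (λ a b → a :* b := (b :* con (+ 1)) :* a) refl (e k) (w i))) ⟩
        ζ₂ (+ 1) (s ℤ.- + 1)                    ∎

    private
      d : Fin n → Fin n → Carrier
      d i k = (z i - z k) ⁻¹

    -- Σ_{t<m} ζ(t+1, m-t) = -ζ(m) - c ζ(m+1): weight the relations by
    -- z_k^(-m), sum over k and symmetrise the double sum
    power-sum-recursion : ∀ m → - (c * ζℕ (suc m)) ≈ ζℕ m + Σ {m} (λ t → ζ₂ℕ (suc (toℕ t)) (m ℕ.∸ toℕ t))
    power-sum-recursion m = begin
      - (c * ζℕ (suc m))                                        ≈⟨ solve 2 (λ a b → :- b := a :+ (:- a :- b)) refl (ζℕ m) _ ⟩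
      ζℕ m + (- ζℕ m - c * ζℕ (suc m))                          ≈⟨ +-congˡ (sym weighted) ⟩
      ζℕ m + Σ (λ k → W k * Σ≠ k (λ i → d i k))                 ≈⟨ +-congˡ symmetrised ⟩
      ζℕ m + Σ (λ k → Σ< k (λ i → W k * d i k + W i * d k i))
        ≈⟨ +-congˡ (Σ-cong (λ k → ΣWhen-cong (λ i → toℕ i ℕ.<? toℕ k) (λ i i<k →
             symmetrised-pair m (nonzero i) (nonzero k) (distinct i k (λ i≡k → ℕP.<-irrefl (P.cong toℕ i≡k) i<k))))) ⟩
      ζℕ m + Σ (λ k → Σ< k (λ i → H m (w k) (w i)))            ≈⟨ +-congˡ expand ⟩
      ζℕ m + Σ {m} (λ t → ζ₂ℕ (suc (toℕ t)) (m ℕ.∸ toℕ t))      ∎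
      where
      W : Fin n → Carrier
      W k = w k ^ℕ m
      weighted : Σ (λ k → W k * Σ≠ k (λ i → d i k)) ≈ - ζℕ m - c * ζℕ (suc m)
      weighted = begin
        Σ (λ k → W k * Σ≠ k (λ i → d i k))
          ≈⟨ Σ-cong (λ k → trans (*-congˡ (relation k))
               (solve 3 (λ W c w → W :* (:- con (+ 1) :- c :* w) := :- W :+ :- (c :* (w :* W))) refl (W k) c (w k))) ⟩
        Σ (λ k → - W k + - (c * (w k * W k)))
          ≈⟨ Σ-+ (λ k → - W k) (λ k → - (c * (w k * W k))) ⟩
        Σ (λ k → - W k) + Σ (λ k → - (c * (w k * W k)))
          ≈⟨ +-cong (Σ-neg W) (trans (Σ-neg (λ k → c * (w k * W k))) (-‿cong (Σ-*ˡ c (λ k → w k * W k)))) ⟩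
        - ζℕ m - c * ζℕ (suc m) ∎
      symmetrised : Σ (λ k → W k * Σ≠ k (λ i → d i k)) ≈ Σ (λ k → Σ< k (λ i → W k * d i k + W i * d k i))
      symmetrised = begin
        Σ (λ k → W k * Σ≠ k (λ i → d i k))
          ≈⟨ Σ-cong (λ k → trans (distribˡ (W k) _ _)
               (+-cong (sym (ΣWhen-*ˡ (λ i → toℕ i ℕ.<? toℕ k) (W k) (λ i → d i k)))
                       (sym (ΣWhen-*ˡ (λ i → toℕ k ℕ.<? toℕ i) (W k) (λ i → d i k))))) ⟩
        Σ (λ k → Σ< k (λ i → W k * d i k) + Σ> k (λ i → W k * d i k))
          ≈⟨ Σ-+ (λ k → Σ< k (λ i → W k * d i k)) (λ k → Σ> k (λ i → W k * d i k)) ⟩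
        Σ (λ k → Σ< k (λ i → W k * d i k)) + Σ (λ k → Σ> k (λ i → W k * d i k))
          ≈⟨ +-congˡ (Σ-triangle (λ k i → W k * d i k)) ⟩
        Σ (λ k → Σ< k (λ i → W k * d i k)) + Σ (λ k → Σ< k (λ i → W i * d k i))
          ≈⟨ sym (Σ-+ (λ k → Σ< k (λ i → W k * d i k)) (λ k → Σ< k (λ i → W i * d k i))) ⟩
        Σ (λ k → Σ< k (λ i → W k * d i k) + Σ< k (λ i → W i * d k i))
          ≈⟨ Σ-cong (λ k → sym (ΣWhen-+ (λ i → toℕ i ℕ.<? toℕ k) (λ i → W k * d i k) (λ i → W i * d k i))) ⟩
        Σ (λ k → Σ< k (λ i → W k * d i k + W i * d k i)) ∎
      term : Fin n → Fin n → Fin m → Carrier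
      term k i t = w k ^ℕ suc (toℕ t) * w i ^ℕ (m ℕ.∸ toℕ t)
      expand : Σ (λ k → Σ< k (λ i → H m (w k) (w i))) ≈ Σ {m} (λ t → ζ₂ℕ (suc (toℕ t)) (m ℕ.∸ toℕ t))
      expand = begin
        Σ (λ k → Σ< k (λ i → H m (w k) (w i)))
          ≈⟨ Σ-cong (λ k → ΣWhen-Σ (λ i → toℕ i ℕ.<? toℕ k) (term k)) ⟩
        Σ (λ k → Σ {m} (λ t → Σ< k (λ i → term k i t)))
          ≈⟨ Σ-swap (λ k t → Σ< k (λ i → term k i t)) ⟩
        Σ {m} (λ t → ζ₂ℕ (suc (toℕ t)) (m ℕ.∸ toℕ t)) ∎

    ζℕ-product : ∀ a b → ζℕ a * ζℕ b ≈ ζℕ (a ℕ.+ b) + ζ₂ℕ a b + ζ₂ℕ b a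
    ζℕ-product a b = begin
      ζℕ a * ζℕ b                                    ≈⟨ trans (*-comm _ _) (sym (Σ-*ˡ (ζℕ b) (λ i → w i ^ℕ a))) ⟩
      Σ (λ i → ζℕ b * w i ^ℕ a)                      ≈⟨ Σ-cong (λ i → trans (*-comm _ _) (sym (Σ-*ˡ (w i ^ℕ a) (λ j → w j ^ℕ b)))) ⟩
      Σ (λ i → Σ (λ j → f i j))                      ≈⟨ Σ-cong (λ i → Σ-split i (f i)) ⟩
      Σ (λ i → f i i + (Σ< i (f i) + Σ> i (f i)))
        ≈⟨ trans (Σ-+ (λ i → f i i) (λ i → Σ< i (f i) + Σ> i (f i))) (+-congˡ (Σ-+ (λ i → Σ< i (f i)) (λ i → Σ> i (f i)))) ⟩
      Σ (λ i → f i i) + (ζ₂ℕ a b + Σ (λ i → Σ> i (f i)))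
        ≈⟨ +-cong (Σ-cong (λ i → sym (^-+ (w i) a b)))
                  (+-congˡ (trans (Σ-triangle f)
                    (Σ-cong (λ j → ΣWhen-cong (λ i → toℕ i ℕ.<? toℕ j) (λ i _ → *-comm (w i ^ℕ a) (w j ^ℕ b)))))) ⟩
      ζℕ (a ℕ.+ b) + (ζ₂ℕ a b + ζ₂ℕ b a)             ≈⟨ sym (+-assoc _ _ _) ⟩
      ζℕ (a ℕ.+ b) + ζ₂ℕ a b + ζ₂ℕ b a               ∎
      where
      f : Fin n → Fin n → Carrier
      f i j = w i ^ℕ a * w j ^ℕ b

  module CharacteristicZero (charZero : CharZero) where

    -- (j+1)(2n-j) b_{j+1} = 2(n-j) bⱼ in F, for bⱼ = besselTerm n (n - j) and n = j + 1 + k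
    bessel-recurrence : ∀ j k → let n = suc (j ℕ.+ k) in
      ι (suc j) * ι (n ℕ.+ suc k) * besselTerm n k ≈ ι (2 ℕ.* suc k) * besselTerm n (suc k)
    bessel-recurrence j k = cross-multiply (denominator≉0 k) (denominator≉0 (suc k)) (begin
      ι (suc j) * ι (n ℕ.+ suc k) * ι ((n ℕ.+ k) !) * ι (besselDenominator n (suc k))
        ≈⟨ sym (ι-*³ (suc j) (n ℕ.+ suc k) ((n ℕ.+ k) !) (besselDenominator n (suc k))) ⟩
      ι (suc j ℕ.* (n ℕ.+ suc k) ℕ.* (n ℕ.+ k) ! ℕ.* besselDenominator n (suc k))
        ≡⟨ P.cong ι (bessel-recurrenceℕ j k) ⟩
      ι (2 ℕ.* suc k ℕ.* (n ℕ.+ suc k) ! ℕ.* besselDenominator n k)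
        ≈⟨ ι-*² (2 ℕ.* suc k) ((n ℕ.+ suc k) !) (besselDenominator n k) ⟩
      ι (2 ℕ.* suc k) * ι ((n ℕ.+ suc k) !) * ι (besselDenominator n k) ∎)
      where
      n : ℕ
      n = suc (j ℕ.+ k)
      denominator≉0 : ∀ m → ¬ (ι (besselDenominator n m) ≈ 0#)
      denominator≉0 m = ι-nonzero charZero (besselDenominator-nonzero n m)

    -- the coefficient of x^j in x θ″ − 2 (x + n) θ′ + 2 n θ vanishes for j < n
    bessel-interior : ∀ n j k → n ≡ suc (j ℕ.+ k) →
      ι (suc j) * (ι j - two * ι n) * coef (besselPoly n) (suc j) + two * (ι n - ι j) * coef (besselPoly n) j ≈ 0#
    bessel-interior .(suc (j ℕ.+ k)) j k P.refl = begin
      ι (suc j) * (ι j - two * ι n) * coef (besselPoly n) (suc j) + two * (ι n - ι j) * coef (besselPoly n) j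
        ≡⟨ P.cong₂ (λ c₁ c₀ → ι (suc j) * (ι j - two * ι n) * c₁ + two * (ι n - ι j) * c₀) b₁≡ b₀≡ ⟩
      (1# + u) * (u - two * ι n) * b₁ + two * (ι n - u) * b₀
        ≈⟨ +-cong (*-congʳ (*-congˡ (+-congˡ (-‿cong (*-congˡ ιn≈))))) (*-congʳ (*-congˡ (+-congʳ ιn≈))) ⟩
      (1# + u) * (u - two * (u + v)) * b₁ + two * ((u + v) - u) * b₀
        ≈⟨ solve 4 (λ u v b₁ b₀ →
             (con (+ 1) :+ u) :* (u :- (con (+ 1) :+ con (+ 1)) :* (u :+ v)) :* b₁ :+ (con (+ 1) :+ con (+ 1)) :* ((u :+ v) :- u) :* b₀
             := (con (+ 1) :+ con (+ 1)) :* v :* b₀ :- (con (+ 1) :+ u) :* ((u :+ v) :+ v) :* b₁) refl u v b₁ b₀ ⟩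
      two * v * b₀ - (1# + u) * ((u + v) + v) * b₁
        ≈⟨ +-congˡ (-‿cong recurrence) ⟩
      two * v * b₀ - two * v * b₀
        ≈⟨ -‿inverseʳ _ ⟩
      0# ∎
      where
      n : ℕ
      n = suc (j ℕ.+ k)
      u v b₀ b₁ : Carrier
      u = ι j
      v = ι (suc k)
      b₀ = besselTerm n (suc k)
      b₁ = besselTerm n k
      b₁≡ : coef (besselPoly n) (suc j) ≡ b₁
      b₁≡ = P.trans (coef-applyUpTo-< (λ i → besselTerm n (n ℕ.∸ i)) (suc n) (suc j) (ℕ.s≤s (ℕ.s≤s (ℕP.m≤m+n j k))))
                    (P.cong (besselTerm n) (ℕP.m+n∸m≡n j k))
      b₀≡ : coef (besselPoly n) j ≡ b₀
      b₀≡ = P.trans (coef-applyUpTo-< (λ i → besselTerm n (n ℕ.∸ i)) (suc n) j (ℕ.s≤s (ℕP.m≤n⇒m≤1+n (ℕP.m≤m+n j k))))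
                    (P.cong (besselTerm n) (P.trans (P.cong (ℕ._∸ j) (P.sym (ℕP.+-suc j k))) (ℕP.m+n∸m≡n j (suc k))))
      ιn≈ : ι n ≈ u + v
      ιn≈ = trans (reflexive (P.cong ι (P.sym (ℕP.+-suc j k)))) (ι-+ j (suc k))
      recurrence : (1# + u) * ((u + v) + v) * b₁ ≈ two * v * b₀
      recurrence = begin
        (1# + u) * ((u + v) + v) * b₁       ≈⟨ *-congʳ (*-congˡ (sym (trans (ι-+ n (suc k)) (+-congʳ ιn≈)))) ⟩
        ι (suc j) * ι (n ℕ.+ suc k) * b₁    ≈⟨ bessel-recurrence j k ⟩
        ι (2 ℕ.* suc k) * b₀                ≈⟨ *-congʳ (trans (ι-* 2 (suc k)) (*-congʳ (+-congˡ (+-identityʳ 1#)))) ⟩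
        two * v * b₀                        ∎

    bessel-equation : ∀ n j → coef (besselOp n (besselPoly n)) j ≈ 0#
    bessel-equation n j = trans (coef-besselOp n (besselPoly n) j) (by-position (ℕP.<-cmp j n))
      where
      b : Poly
      b = besselPoly n
      f : ℕ → Carrier
      f i = besselTerm n (n ℕ.∸ i)
      by-position : Tri (j ℕ.< n) (j ≡ n) (n ℕ.< j) →
        ι (suc j) * (ι j - two * ι n) * coef b (suc j) + two * (ι n - ι j) * coef b j ≈ 0#
      by-position (tri< j<n _ _) = bessel-interior n j (n ℕ.∸ suc j) (P.sym (ℕP.m+[n∸m]≡n j<n))
      by-position (tri≈ _ P.refl _) rewrite coef-applyUpTo-≥ f (suc n) (suc n) ℕP.≤-refl =
        solve 3 (λ a N c → a :* con (+ 0) :+ (con (+ 1) :+ con (+ 1)) :* (N :- N) :* c := con (+ 0)) refl _ (ι n) _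
      by-position (tri> _ _ n<j) rewrite coef-applyUpTo-≥ f (suc n) j n<j
                                       | coef-applyUpTo-≥ f (suc n) (suc j) (ℕP.m≤n⇒m≤1+n n<j) =
        solve 2 (λ a d → a :* con (+ 0) :+ d :* con (+ 0) := con (+ 0)) refl _ _

    module Zeros (n : ℕ) (z : Fin n → Carrier) (zeros : IsZeroList n z)
                 (nonzero : ∀ i → ¬ (z i ≈ 0#)) (distinct : Distinct z) where

      open IdentityTheorem (λ i → ι (suc i))
        (λ i j i≢j e → i≢j (ℕP.suc-injective (ι-injective charZero (suc i) (suc j) e)))
        (λ i → charZero i)

      besselPoly≋rootPoly : besselPoly n ≋ rootPoly z
      besselPoly≋rootPoly = polynomial-identity (besselPoly n) (rootPoly z) (λ i → begin
        ev (besselPoly n) (ι (suc i))      ≈⟨ sym (θ≈besselPoly n (ι (suc i))) ⟩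
        θ n (ι (suc i))                    ≈⟨ zeros (ι (suc i)) ⟩
        Π (λ j → ι (suc i) - z j)          ≈⟨ sym (ev-rootPoly z (ι (suc i))) ⟩
        ev (rootPoly z) (ι (suc i))        ∎)

      rootPoly-equation : ∀ y → ev (besselOp n (rootPoly z)) y ≈ 0#
      rootPoly-equation = ≋-ev (besselOp n (rootPoly z)) []
        (λ j → trans (besselOp-≋ n {rootPoly z} {besselPoly n} (λ i → sym (besselPoly≋rootPoly i)) j)
                     (bessel-equation n j))

      stieltjes : ∀ k → z k * Σ≠ k (λ i → (z k - z i) ⁻¹) ≈ z k + ι n
      stieltjes k = sym (x-y≈0⇒x≈y (zero-product (nonzero-* (two-nonzero charZero) P′≉0) (begin
        two * P′ * (y * S - (y + ι n))
          ≈⟨ solve 5 (λ t P′ y S N → t :* P′ :* (y :* S :- (y :+ N))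
                := y :* (t :* P′ :* S) :+ ((:- t) :* (y :* P′ :+ N :* P′) :+ t :* N :* con (+ 0)))
                refl two P′ y S (ι n) ⟩
        y * (two * P′ * S) + (- two * (y * P′ + ι n * P′) + two * ι n * 0#)
          ≈⟨ sym (+-cong (*-congˡ P″≈) (+-congˡ (*-congˡ P≈0))) ⟩
        y * ev (D (D P)) y + (- two * (y * P′ + ι n * P′) + two * ι n * ev P y)
          ≈⟨ sym (ev-besselOp n P y) ⟩
        ev (besselOp n P) y
          ≈⟨ rootPoly-equation y ⟩
        0# ∎)))
        where
        P : Poly
        P = rootPoly z
        y P′ S : Carrier
        y = z k
        P′ = ev (D P) y
        S = Σ≠ k (λ i → (y - z i) ⁻¹)
        root : ev P y ≈ 0# × ¬ (P′ ≈ 0#) × ev (D (D P)) y ≈ two * P′ * S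
        root = at-root z distinct k
        P≈0 : ev P y ≈ 0#
        P≈0 = proj₁ root
        P′≉0 : ¬ (P′ ≈ 0#)
        P′≉0 = proj₁ (proj₂ root)
        P″≈ : ev (D (D P)) y ≈ two * P′ * S
        P″≈ = proj₂ (proj₂ root)
        x-y≈0⇒x≈y : ∀ {a b} → a - b ≈ 0# → b ≈ a
        x-y≈0⇒x≈y {a} {b} e = sym (G.x∙y⁻¹≈ε⇒x≈y a b e)

      reciprocal-differences : ∀ k → Σ≠ k (λ i → (z i - z k) ⁻¹) ≈ - 1# - ι n * z k ⁻¹
      reciprocal-differences k = begin
        Σ≠ k (λ i → (z i - z k) ⁻¹)       ≈⟨ Σ≠-cong k (λ i i≢k → inverse-swap (distinct k i (λ e → i≢k (P.sym e)))) ⟩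
        Σ≠ k (λ i → - (z k - z i) ⁻¹)     ≈⟨ Σ≠-neg k (λ i → (z k - z i) ⁻¹) ⟩
        - S                               ≈⟨ -‿cong (begin
          S                                 ≈⟨ sym (*-identityˡ S) ⟩
          1# * S                            ≈⟨ *-congʳ (sym (inverseˡ (nonzero k))) ⟩
          (z k ⁻¹ * z k) * S                ≈⟨ *-assoc _ _ _ ⟩
          z k ⁻¹ * (z k * S)                ≈⟨ *-congˡ (stieltjes k) ⟩
          z k ⁻¹ * (z k + ι n)              ≈⟨ distribˡ _ _ _ ⟩
          z k ⁻¹ * z k + z k ⁻¹ * ι n       ≈⟨ +-cong (inverseˡ (nonzero k)) (*-comm _ _) ⟩
          1# + ι n * z k ⁻¹                 ∎) ⟩
        - (1# + ι n * z k ⁻¹)             ≈⟨ sym (AG.⁻¹-∙-comm _ _) ⟩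
        - 1# - ι n * z k ⁻¹               ∎
        where
        S : Carrier
        S = Σ≠ k (λ i → (z k - z i) ⁻¹)

      open PowerSums z nonzero distinct (ι n) reciprocal-differences public
      open Zeta z

      half-inverse : two * half ≈ 1#
      half-inverse = inverse two (two-nonzero charZero)

      ν-half : ν n - half ≈ ι n
      ν-half = solve 2 (λ a h → (a :+ h) :- h := a) refl (ι n) half

      half-ν : - ι n ≈ half - ν n
      half-ν = solve 2 (λ a h → :- a := h :- (a :+ h)) refl (ι n) half

      one-2ν : 1# - two * ν n ≈ - (two * ι n)
      one-2ν = begin
        1# - two * ν n                 ≈⟨ solve 3 (λ t a h → con (+ 1) :- t :* (a :+ h) := :- (t :* a) :- (t :* h :- con (+ 1))) refl two (ι n) half ⟩
        - (two * ι n) - (two * half - 1#) ≈⟨ +-congˡ (-‿cong (trans (+-congʳ half-inverse) (-‿inverseʳ 1#))) ⟩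
        - (two * ι n) - 0#             ≈⟨ trans (+-congˡ G.ε⁻¹≈ε) (+-identityʳ _) ⟩
        - (two * ι n)                  ∎

      three-halves-ν : 1# - ι n ≈ (1# + 1# + 1#) * half - ν n
      three-halves-ν = sym (begin
        (1# + 1# + 1#) * half - ν n    ≈⟨ solve 2 (λ a h → (con (+ 1) :+ con (+ 1) :+ con (+ 1)) :* h :- (a :+ h) := con (+ 1) :- a :+ ((con (+ 1) :+ con (+ 1)) :* h :- con (+ 1))) refl (ι n) half ⟩
        1# - ι n + (two * half - 1#)   ≈⟨ +-congˡ (trans (+-congʳ half-inverse) (-‿inverseʳ 1#)) ⟩
        1# - ι n + 0#                  ≈⟨ +-identityʳ _ ⟩
        1# - ι n                       ∎)

      z̃-formula : ∀ k → invZt k ≈ (- 1# - (ν n - half) / z k - Σ> k (λ j → z j ⁻¹))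
      z̃-formula k = trans (invZt≈ k) (+-congʳ (+-congˡ (-‿cong (*-congʳ (sym ν-half)))))

      ζ̃-formula : ∀ s → ζ̃ s ≈ ((half - ν n) * ζ s - ζ (s ℤ.- + 1) - ζ₂ (+ 1) (s ℤ.- + 1))
      ζ̃-formula s = trans (ζ̃≈ s) (+-congʳ (+-congʳ (*-congʳ half-ν)))

      ζ-recursion : 1 ≤ n → ∀ (s : ℕ) → ζ (+ (s ℕ.+ 3)) ≈
           ((1# + 1#) / (1# - (1# + 1#) * ν n))
           * (ζ (+ (s ℕ.+ 2))
              + Σ {ℕ.suc (ℕ.suc s)} (λ t →
                  let a = (+ toℕ t) ℤ.- + 1 in
                  let b = (+ s) ℤ.- a in
                  ζ₂ (+ 2 ℤ.+ a) (+ 1 ℤ.+ b)))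
      ζ-recursion n≥1 s = sym (begin
        two * δ ⁻¹ * (ζ (+ (s ℕ.+ 2)) + Σ {m} (λ t → ζ₂ (+ 2 ℤ.+ ((+ toℕ t) ℤ.- + 1)) (+ 1 ℤ.+ ((+ s) ℤ.- ((+ toℕ t) ℤ.- + 1)))))
          ≈⟨ *-congˡ (+-cong (trans (ζ≈ζℕ (s ℕ.+ 2)) (reflexive (P.cong ζℕ (ℕP.+-comm s 2)))) (Σ-cong exponents)) ⟩
        two * δ ⁻¹ * (ζℕ m + Σ {m} (λ t → ζ₂ℕ (suc (toℕ t)) (m ℕ.∸ toℕ t)))
          ≈⟨ *-congˡ (sym (power-sum-recursion m)) ⟩
        two * δ ⁻¹ * - (ι n * ζℕ (suc m))
          ≈⟨ solve 4 (λ t di a Z → t :* di :* (:- (a :* Z)) := di :* (:- (t :* a)) :* Z) refl two (δ ⁻¹) (ι n) (ζℕ (suc m)) ⟩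
        δ ⁻¹ * - (two * ι n) * ζℕ (suc m)  ≈⟨ *-congʳ (*-congˡ (sym one-2ν)) ⟩
        δ ⁻¹ * δ * ζℕ (suc m)              ≈⟨ *-congʳ (inverseˡ δ≉0) ⟩
        1# * ζℕ (suc m)                    ≈⟨ *-identityˡ _ ⟩
        ζℕ (suc m)                         ≈⟨ sym (trans (ζ≈ζℕ (s ℕ.+ 3)) (reflexive (P.cong ζℕ (ℕP.+-comm s 3)))) ⟩
        ζ (+ (s ℕ.+ 3))                    ∎)
        where
        m : ℕ
        m = suc (suc s)
        δ : Carrier
        δ = 1# - two * ν n
        δ≉0 : ¬ (δ ≈ 0#)
        δ≉0 e = nonzero-neg (nonzero-* (two-nonzero charZero) (ι-nonzero charZero (ℕP.m<n⇒n≢0 n≥1)))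
                  (trans (sym one-2ν) e)
        exponents : ∀ (t : Fin m) →
          ζ₂ (+ 2 ℤ.+ ((+ toℕ t) ℤ.- + 1)) (+ 1 ℤ.+ ((+ s) ℤ.- ((+ toℕ t) ℤ.- + 1))) ≈ ζ₂ℕ (suc (toℕ t)) (m ℕ.∸ toℕ t)
        exponents t = trans (reflexive (P.cong₂ ζ₂ (first-exponent (toℕ t)) (second-exponent s (toℕ t) (ℕP.<⇒≤ (FinP.toℕ<n t)))))
                            (ζ₂≈ζ₂ℕ (suc (toℕ t)) (m ℕ.∸ toℕ t))

      ζ-identity : (ζ (+ 2) + ζ (+ 1) * ζ (+ 2)) ≈ (((1# + 1# + 1#) * half - ν n) * ζ (+ 3))
      ζ-identity = begin
        ζ (+ 2) + ζ (+ 1) * ζ (+ 2)          ≈⟨ +-cong (ζ≈ζℕ 2) (*-cong (ζ≈ζℕ 1) (ζ≈ζℕ 2)) ⟩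
        ζℕ 2 + ζℕ 1 * ζℕ 2                   ≈⟨ +-congˡ (ζℕ-product 1 2) ⟩
        ζℕ 2 + (ζℕ 3 + ζ₂ℕ 1 2 + ζ₂ℕ 2 1)
          ≈⟨ solve 4 (λ a b c d → a :+ (b :+ c :+ d) := b :+ (a :+ (c :+ (d :+ con (+ 0))))) refl (ζℕ 2) (ζℕ 3) (ζ₂ℕ 1 2) (ζ₂ℕ 2 1) ⟩
        ζℕ 3 + (ζℕ 2 + (ζ₂ℕ 1 2 + (ζ₂ℕ 2 1 + 0#)))
                                             ≈⟨ +-congˡ (sym (power-sum-recursion 2)) ⟩
        ζℕ 3 + - (ι n * ζℕ 3)                ≈⟨ solve 2 (λ Z a → Z :+ :- (a :* Z) := (con (+ 1) :- a) :* Z) refl (ζℕ 3) (ι n) ⟩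
        (1# - ι n) * ζℕ 3                    ≈⟨ *-cong three-halves-ν (sym (ζ≈ζℕ 3)) ⟩
        ((1# + 1# + 1#) * half - ν n) * ζ (+ 3) ∎

theorem5p4 : ∀ {c ℓ} (F : Field c ℓ) → let open Field F in let open FieldOps F in
    CharZero →
    (n : ℕ) → 1 ≤ n →
    (z : Fin n → Carrier) → IsZeroList n z →
    (∀ i → ¬ (z i ≈ 0#)) →
    (∀ i j → ¬ (i ≡ j) → ¬ (z i ≈ z j)) →
    let open Zeta z in
    (∀ (k : Fin n) → invZt k ≈ (- 1# - (ν n - half) / z k - Σ> k (λ j → z j ⁻¹)))
    × (∀ (s : ℤ) → ζ̃ s ≈ ((half - ν n) * ζ s - ζ (s ℤ.- + 1) - ζ₂ (+ 1) (s ℤ.- + 1)))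
    × (∀ (s : ℕ) → ζ (+ (s ℕ.+ 3)) ≈
         ((1# + 1#) / (1# - (1# + 1#) * ν n))
         * (ζ (+ (s ℕ.+ 2))
            + Σ {ℕ.suc (ℕ.suc s)} (λ t →
                let a = (+ toℕ t) ℤ.- + 1 in
                let b = (+ s) ℤ.- a in
                ζ₂ (+ 2 ℤ.+ a) (+ 1 ℤ.+ b))))
    × ((ζ (+ 2) + ζ (+ 1) * ζ (+ 2)) ≈ (((1# + 1# + 1#) * half - ν n) * ζ (+ 3)))
theorem5p4 F charZero n n≥1 z zeros nonzero distinct =
  z̃-formula , ζ̃-formula , ζ-recursion n≥1 , ζ-identity
  where open FieldTheory.CharacteristicZero F charZero
        open Zeros n z zeros nonzero distinct
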